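{- For a graph $G$ on $n$ vertices, let $N(G)$ be the number of $4$-element vertex subsets of $G$ whose induced subgraph consists of two vertex-disjoint edges. Then \[\lim_{n\to\infty}\ \max_{G}\ \frac{N(G)}{\binom{n}{4}}=\frac{3}{32},\] where the maximum is over all bipartite graphs $G$ with $n$ vertices. -}

module Defs where

open import Data.Bool using (Bool; true; false; _∧_; _∨_; not; if_then_else_)
open import Data.Nat using (ℕ; zero; suc; _<ᵇ_; _⊔_)
open import Data.Nat.Combinatorics using (_C_)
open import Data.Fin using (Fin; toℕ)
open import Data.List using (List; []; _∷_; [_]; map; concatMap; filter; length; allFin; foldr)
open import Data.Bool.ListAction using (all; any)
open import Data.Vec using (Vec; lookup) renaming ([] to []v; _∷_ to _∷v_)
open import Data.Integer using (+_)
open import Data.Rational using (ℚ; _/_; 0ℚ)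
open import Relation.Nullary.Decidable using (T?)

allVecs : {A : Set} → List A → (n : ℕ) → List (Vec A n)
allVecs xs zero = [ []v ]
allVecs xs (suc n) = concatMap (λ x → map (x ∷v_) (allVecs xs n)) xs

bools : List Bool
bools = true ∷ false ∷ []

-- A (labelled) graph on vertex set Fin n, given by its adjacency matrix.
Matrix : ℕ → Set
Matrix n = Vec (Vec Bool n) n

adj : {n : ℕ} → Matrix n → Fin n → Fin n → Bool
adj M i j = lookup (lookup M i) j

_==_ : Bool → Bool → Bool
true == b = b
false == b = not b

isSimple : {n : ℕ} → Matrix n → Bool
isSimple {n} M = all (λ i → not (adj M i i) ∧ all (λ j → adj M i j == adj M j i) (allFin n)) (allFin n)

isBipartite : {n : ℕ} → Matrix n → Bool
isBipartite {n} M = any (λ c → all (λ i → all (λ j → not (adj M i j) ∨ not (lookup c i == lookup c j)) (allFin n)) (allFin n)) (allVecs bools n)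

bipartiteGraphs : (n : ℕ) → List (Matrix n)
bipartiteGraphs n = filter (λ M → T? (isSimple M ∧ isBipartite M)) (allVecs (allVecs bools n) n)

twoDisjointEdges : {n : ℕ} → Matrix n → Fin n → Fin n → Fin n → Fin n → Bool
twoDisjointEdges M a b c d =
     (e a b ∧ e c d ∧ not (e a c) ∧ not (e a d) ∧ not (e b c) ∧ not (e b d))
   ∨ (e a c ∧ e b d ∧ not (e a b) ∧ not (e a d) ∧ not (e b c) ∧ not (e c d))
   ∨ (e a d ∧ e b c ∧ not (e a b) ∧ not (e a c) ∧ not (e b d) ∧ not (e c d))
  where e = adj M

-- 4-element vertex subsets, listed as strictly increasing quadruples.
record Quad (n : ℕ) : Set where
  constructor quad
  field a b c d : Fin n

quads : (n : ℕ) → List (Quad n)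
quads n = concatMap (λ a → concatMap (λ b → concatMap (λ c → map (λ d → quad a b c d)
            (filter (λ d → T? (toℕ c <ᵇ toℕ d)) (allFin n)))
            (filter (λ c → T? (toℕ b <ᵇ toℕ c)) (allFin n)))
            (filter (λ b → T? (toℕ a <ᵇ toℕ b)) (allFin n))) (allFin n)

N : {n : ℕ} → Matrix n → ℕ
N {n} M = length (filter (λ q → T? (twoDisjointEdges M (Quad.a q) (Quad.b q) (Quad.c q) (Quad.d q))) (quads n))

-- max over bipartite graphs G on n vertices of N(G)  (the list is nonempty: the empty graph)
maxN : ℕ → ℕ
maxN n = foldr _⊔_ 0 (map N (bipartiteGraphs n))

-- p / q as a rational (q = 0 gives 0; only relevant for n < 4).
frac : ℕ → ℕ → ℚ
frac p zero = 0ℚ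
frac p (suc q) = (+ p) / suc q

density : ℕ → ℚ
density n = frac (maxN n) (n C 4)

module Submission where

-- Let G be bipartite with a proper 2-colouring.  If a, b, c, d induce the
-- two edges ab and cd, then cd joins the two sides, so a lies on the side of exactly
-- one of c, d; counting ordered quadruples gives 24 N ≤ 6 ∑ f(a,c) f(c,a) over pairs
-- a, c on the same side, where f(a,c) = |N(a) ∖ N(c)|.  By AM-GM,
-- 4 f(a,c) f(c,a) ≤ |N(a) Δ N(c)|².  Expanding the square, ∑ |N(a) Δ N(c)|² counts,
-- for every pair b, d, the pairs a, c opposite to both that are separated by b and by
-- d; by AM-GM again these are at most half the square of that side, which gives
-- 16 ∑ |N(a) Δ N(c)|² ≤ n⁴ and so 256 N ≤ n⁴.  Two disjoint copies of K_{m,m} with m = ⌊n/4⌋ have N ≥ m⁴ ≥ (n - 3)⁴ / 256.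
-- Since also (n - 3)⁴ ≤ 24 C(n,4) ≤ n⁴, the density tends to 24 / 256 = 3 / 32.

open import Data.Bool using (Bool; true; false; _∧_; _∨_; not; T)
open import Data.Bool.ListAction using (all; any)
open import Data.Bool.Properties using (∧-comm; ∧-assoc; T-∧; T-∨; T-≡)
open import Data.Empty using (⊥-elim)
open import Data.Fin using (Fin; zero; suc; toℕ)
open import Data.Integer as ℤ using (+<+; +[1+_]; -[1+_])
import Data.Integer.Properties as ℤ
open import Data.List using (List; []; _∷_; _++_; map; concatMap; filter; length; allFin; tabulate; foldr)
open import Data.List.Membership.Propositional using (_∈_)
open import Data.List.Membership.Propositional.Properties using (∈-allFin; ∈-map⁺; ∈-concat⁺′; ∈-filter⁺)
open import Data.List.Relation.Unary.All as All using (All; []; _∷_)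
open import Data.List.Relation.Unary.All.Properties using (all⁺; all⁻; all-filter; map⁺)
open import Data.List.Relation.Unary.Any as Any using (here; there; satisfied)
open import Data.List.Relation.Unary.Any.Properties using (any⁺; any⁻)
open import Data.Maybe using (Maybe; just; nothing)
open import Data.Nat
open import Data.Nat.Combinatorics using (_C_; nC1≡n; nCk+nC[k+1]≡[n+1]C[k+1])
open import Data.Nat.Coprimality using (Coprime)
open import Data.Nat.Divisibility using (divides-refl)
open import Data.Nat.DivMod
open import Data.Nat.Properties
open import Algebra.Properties.Semiring.Sum +-*-semiring
  using (sum; sum-syntax; sum-cong-≗; ∑-distrib-+; ∑-comm; *-distribˡ-sum; *-distribʳ-sum)
open import Data.Nat.Tactic.RingSolver using (solve-∀)
open import Data.Product using (_×_; _,_; proj₁; proj₂; ∃-syntax)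
open import Data.Rational as ℚ using (ℚ; mkℚ; 0ℚ)
import Data.Rational.Properties as ℚ
import Data.Rational.Unnormalised as ℚᵘ
import Data.Rational.Unnormalised.Properties as ℚᵘ
open import Algebra.Properties.AbelianGroup ℚ.+-0-abelianGroup using (xyx⁻¹≈y; ⁻¹-anti-homo‿-)
open import Data.Sum using (inj₁; inj₂; [_,_]′)
open import Data.Vec as Vec using (Vec; lookup) renaming ([] to []ᵥ; _∷_ to _∷ᵥ_)
open import Data.Vec.Properties using (lookup∘tabulate)
open import Function using (_∘_; Equivalence)
open import Relation.Binary.PropositionalEquality
open import Relation.Nullary using (contradiction)
open import Relation.Nullary.Decidable using (T?)

open import Defs

𝟙 : Bool → ℕ
𝟙 true = 1
𝟙 false = 0

𝟙≤1 : ∀ x → 𝟙 x ≤ 1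
𝟙≤1 true = ≤-refl
𝟙≤1 false = z≤n

𝟙-∧ : ∀ x y → 𝟙 (x ∧ y) ≡ 𝟙 x * 𝟙 y
𝟙-∧ true y = sym (+-identityʳ (𝟙 y))
𝟙-∧ false y = refl

==⇒≡ : ∀ {x y} → (x == y) ≡ true → x ≡ y
==⇒≡ {true} {true} _ = refl
==⇒≡ {false} {false} _ = refl

==-refl : ∀ x → (x == x) ≡ true
==-refl true = refl
==-refl false = refl

==-comm : ∀ x y → (x == y) ≡ (y == x)
==-comm true true = refl
==-comm true false = refl
==-comm false true = refl
==-comm false false = refl

∧-false₁ : ∀ {x} y → x ≡ false → x ∧ y ≡ false
∧-false₁ _ refl = refl

∧-false₂ : ∀ x {y} → y ≡ false → x ∧ y ≡ false
∧-false₂ true refl = refl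
∧-false₂ false _ = refl

∧-true₁ : ∀ {x y} → x ∧ y ≡ true → x ≡ true
∧-true₁ {true} _ = refl

∧-true₂ : ∀ {x y} → x ∧ y ≡ true → y ≡ true
∧-true₂ {true} xy = xy

BoolFun : ℕ → Set
BoolFun zero = Bool
BoolFun (suc k) = Bool → BoolFun k

tautology? : ∀ k → BoolFun k → Bool
tautology? zero b = b
tautology? (suc k) F = tautology? k (F true) ∧ tautology? k (F false)

Tautology : ∀ k → BoolFun k → Set
Tautology zero b = b ≡ true
Tautology (suc k) F = ∀ x → Tautology k (F x)

tautology-sound : ∀ k F → tautology? k F ≡ true → Tautology k F
tautology-sound zero b holds = holds
tautology-sound (suc k) F holds true = tautology-sound k (F true) (∧-true₁ holds)
tautology-sound (suc k) F holds false = tautology-sound k (F false) (∧-true₂ {tautology? k (F true)} holds)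

∑-mono-≤ : ∀ {n} {f g : Fin n → ℕ} → (∀ i → f i ≤ g i) → sum f ≤ sum g
∑-mono-≤ {zero} _ = z≤n
∑-mono-≤ {suc n} f≤g = +-mono-≤ (f≤g zero) (∑-mono-≤ (λ i → f≤g (suc i)))

∑1≡n : ∀ n → ∑[ i < n ] 1 ≡ n
∑1≡n zero = refl
∑1≡n (suc n) = cong suc (∑1≡n n)

module _ {n : ℕ} where

  ∑² : (Fin n → Fin n → ℕ) → ℕ
  ∑² h = ∑[ a < n ] ∑[ b < n ] h a b

  ∑³ : (Fin n → Fin n → Fin n → ℕ) → ℕ
  ∑³ h = ∑[ a < n ] ∑² (h a)

  ∑⁴ : (Fin n → Fin n → Fin n → Fin n → ℕ) → ℕ
  ∑⁴ h = ∑[ a < n ] ∑³ (h a)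

  ∑²-cong : ∀ {f g} → (∀ a b → f a b ≡ g a b) → ∑² f ≡ ∑² g
  ∑²-cong f≡g = sum-cong-≗ (λ a → sum-cong-≗ (f≡g a))

  ∑³-cong : ∀ {f g} → (∀ a b c → f a b c ≡ g a b c) → ∑³ f ≡ ∑³ g
  ∑³-cong f≡g = sum-cong-≗ (λ a → ∑²-cong (f≡g a))

  ∑⁴-cong : ∀ {f g} → (∀ a b c d → f a b c d ≡ g a b c d) → ∑⁴ f ≡ ∑⁴ g
  ∑⁴-cong f≡g = sum-cong-≗ (λ a → ∑³-cong (f≡g a))

  ∑²-mono-≤ : ∀ {f g} → (∀ a b → f a b ≤ g a b) → ∑² f ≤ ∑² g
  ∑²-mono-≤ f≤g = ∑-mono-≤ (λ a → ∑-mono-≤ (f≤g a))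

  ∑³-mono-≤ : ∀ {f g} → (∀ a b c → f a b c ≤ g a b c) → ∑³ f ≤ ∑³ g
  ∑³-mono-≤ f≤g = ∑-mono-≤ (λ a → ∑²-mono-≤ (f≤g a))

  ∑⁴-mono-≤ : ∀ {f g} → (∀ a b c d → f a b c d ≤ g a b c d) → ∑⁴ f ≤ ∑⁴ g
  ∑⁴-mono-≤ f≤g = ∑-mono-≤ (λ a → ∑³-mono-≤ (f≤g a))

  ∑²-distrib-+ : ∀ f g → ∑² (λ a b → f a b + g a b) ≡ ∑² f + ∑² g
  ∑²-distrib-+ f g = trans (sum-cong-≗ (λ a → ∑-distrib-+ (f a) (g a))) (∑-distrib-+ {n} _ _)

  ∑³-distrib-+ : ∀ f g → ∑³ (λ a b c → f a b c + g a b c) ≡ ∑³ f + ∑³ g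
  ∑³-distrib-+ f g = trans (sum-cong-≗ (λ a → ∑²-distrib-+ (f a) (g a))) (∑-distrib-+ {n} _ _)

  ∑⁴-distrib-+ : ∀ f g → ∑⁴ (λ a b c d → f a b c d + g a b c d) ≡ ∑⁴ f + ∑⁴ g
  ∑⁴-distrib-+ f g = trans (sum-cong-≗ (λ a → ∑³-distrib-+ (f a) (g a))) (∑-distrib-+ {n} _ _)

  ∑²-swap : ∀ f → ∑² f ≡ ∑² (λ a b → f b a)
  ∑²-swap f = ∑-comm f

  ∑³-swap₁₂ : ∀ f → ∑³ f ≡ ∑³ (λ a b c → f b a c)
  ∑³-swap₁₂ f = ∑-comm (λ a b → sum (f a b))

  ∑³-swap₂₃ : ∀ f → ∑³ f ≡ ∑³ (λ a b c → f a c b)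
  ∑³-swap₂₃ f = sum-cong-≗ (λ a → ∑²-swap (f a))

  ∑⁴-swap₁₂ : ∀ f → ∑⁴ f ≡ ∑⁴ (λ a b c d → f b a c d)
  ∑⁴-swap₁₂ f = ∑-comm (λ a b → ∑² (f a b))

  ∑⁴-swap₂₃ : ∀ f → ∑⁴ f ≡ ∑⁴ (λ a b c d → f a c b d)
  ∑⁴-swap₂₃ f = sum-cong-≗ (λ a → ∑³-swap₁₂ (f a))

  ∑⁴-swap₃₄ : ∀ f → ∑⁴ f ≡ ∑⁴ (λ a b c d → f a b d c)
  ∑⁴-swap₃₄ f = sum-cong-≗ (λ a → ∑³-swap₂₃ (f a))

  ∑²-*ˡ : ∀ k f → k * ∑² f ≡ ∑² (λ a b → k * f a b)
  ∑²-*ˡ k f = trans (*-distribˡ-sum {n} k _) (sum-cong-≗ (λ a → *-distribˡ-sum k (f a)))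

  ∑-*-∑ : ∀ (f g : Fin n → ℕ) → sum f * sum g ≡ ∑² (λ a b → f a * g b)
  ∑-*-∑ f g = trans (*-distribʳ-sum (sum g) f) (sum-cong-≗ (λ a → *-distribˡ-sum (f a) g))

  ∑²-∑²-comm : ∀ (F : Fin n → Fin n → Fin n → Fin n → ℕ) →
               ∑² (λ a c → ∑² (F a c)) ≡ ∑² (λ b d → ∑² (λ a c → F a c b d))
  ∑²-∑²-comm F =
    trans (sum-cong-≗ λ a → ∑-comm (λ c b → ∑[ d < n ] F a c b d))
    (trans (∑-comm (λ a b → ∑² (λ c d → F a c b d)))
    (trans (sum-cong-≗ λ b → sum-cong-≗ λ a → ∑-comm (λ c d → F a c b d))
           (sum-cong-≗ λ b → ∑-comm (λ a d → ∑[ c < n ] F a c b d))))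

  ∑⁴-product : ∀ (f g h k : Fin n → ℕ) →
               sum f * (sum g * (sum h * sum k)) ≡ ∑⁴ (λ a b c d → f a * (g b * (h c * k d)))
  ∑⁴-product f g h k = begin
    sum f * (sum g * (sum h * sum k))            ≡⟨ cong (λ x → sum f * (sum g * x)) (∑-*-∑ h k) ⟩
    sum f * (sum g * ∑² H)                       ≡⟨ cong (sum f *_) (*-distribʳ-sum (∑² H) g) ⟩
    sum f * ∑[ b < n ] (g b * ∑² H)              ≡⟨ ∑-*-∑ f (λ b → g b * ∑² H) ⟩
    ∑² (λ a b → f a * (g b * ∑² H))              ≡⟨ ∑²-cong (λ a b → trans (cong (f a *_) (∑²-*ˡ (g b) H))
                                                      (∑²-*ˡ (f a) (λ c d → g b * H c d))) ⟩
    ∑⁴ (λ a b c d → f a * (g b * (h c * k d)))   ∎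
    where
    open ≡-Reasoning
    H : Fin n → Fin n → ℕ
    H c d = h c * k d

-- Symmetrisation

infix 7 _≺_

_≺_ : ∀ {n} → Fin n → Fin n → Bool
i ≺ j = toℕ i <ᵇ toℕ j

≺⇒< : ∀ {n} (i j : Fin n) → i ≺ j ≡ true → toℕ i < toℕ j
≺⇒< i j i≺j = <ᵇ⇒< (toℕ i) (toℕ j) (Equivalence.from T-≡ i≺j)

<⇒≺ : ∀ {n} {i j : Fin n} → toℕ i < toℕ j → i ≺ j ≡ true
<⇒≺ i<j = Equivalence.to T-≡ (<⇒<ᵇ i<j)

≺-asym : ∀ {n} (i j : Fin n) → i ≺ j ≡ true → j ≺ i ≡ false
≺-asym i j i≺j with j ≺ i in j≺i
... | false = refl
... | true = contradiction (≺⇒< j i j≺i) (<-asym (≺⇒< i j i≺j))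

≺-trans : ∀ {n} (i j k : Fin n) → i ≺ j ≡ true → j ≺ k ≡ true → i ≺ k ≡ true
≺-trans i j k i≺j j≺k = <⇒≺ {i = i} {k} (<-trans (≺⇒< i j i≺j) (≺⇒< j k j≺k))

Excludes : Bool → Bool → Set
Excludes p q = p ≡ true → q ≡ false

𝟙-exclusive₂ : ∀ p q → Excludes p q → 𝟙 p + 𝟙 q ≤ 1
𝟙-exclusive₂ true q p⇒¬q rewrite p⇒¬q refl = ≤-refl
𝟙-exclusive₂ false q _ = 𝟙≤1 q

𝟙-exclusive₃ : ∀ p q r → Excludes p q → Excludes p r → Excludes q r →
               𝟙 p + 𝟙 q + 𝟙 r ≤ 1
𝟙-exclusive₃ true q r p⇒¬q p⇒¬r _ rewrite p⇒¬q refl | p⇒¬r refl = ≤-refl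
𝟙-exclusive₃ false q r _ _ q⇒¬r = 𝟙-exclusive₂ q r q⇒¬r

𝟙-exclusive₄ : ∀ p q r s → Excludes p q → Excludes p r → Excludes p s →
               Excludes q r → Excludes q s → Excludes r s →
               𝟙 p + 𝟙 q + 𝟙 r + 𝟙 s ≤ 1
𝟙-exclusive₄ true q r s p⇒¬q p⇒¬r p⇒¬s _ _ _
  rewrite p⇒¬q refl | p⇒¬r refl | p⇒¬s refl = ≤-refl
𝟙-exclusive₄ false q r s _ _ _ q⇒¬r q⇒¬s r⇒¬s = 𝟙-exclusive₃ q r s q⇒¬r q⇒¬s r⇒¬s

≤1⇒*≤ : ∀ {k} m → k ≤ 1 → k * m ≤ m
≤1⇒*≤ m k≤1 = ≤-trans (*-monoˡ-≤ m k≤1) (≤-reflexive (*-identityˡ m))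

module _ {n : ℕ} where

  least₂ : Fin n → Fin n → Bool
  least₂ a b = a ≺ b

  least₃ : Fin n → Fin n → Fin n → Bool
  least₃ a b c = a ≺ b ∧ a ≺ c

  least₄ : Fin n → Fin n → Fin n → Fin n → Bool
  least₄ a b c d = a ≺ b ∧ a ≺ c ∧ a ≺ d

  sorted₄ : Fin n → Fin n → Fin n → Fin n → Bool
  sorted₄ a b c d = a ≺ b ∧ b ≺ c ∧ c ≺ d

  -- The k events "the i-th variable is the least" are disjoint, and by the symmetry
  -- of the summand each of them contributes the same sum.

  least₂-∑² : ∀ h → (∀ a b → h a b ≡ h b a) →
              2 * ∑² (λ a b → 𝟙 (least₂ a b) * h a b) ≤ ∑² h
  least₂-∑² h h-sym = begin
      2 * L                               ≡⟨ cong (L +_) (+-identityʳ L) ⟩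
      L + L                               ≡⟨ cong (L +_) rotated ⟨
      L + ∑² t₂                           ≡⟨ ∑²-distrib-+ t₁ t₂ ⟨
      ∑² (λ a b → t₁ a b + t₂ a b)        ≤⟨ ∑²-mono-≤ pointwise ⟩
      ∑² h                                ∎
    where
    open ≤-Reasoning
    t₁ t₂ : Fin n → Fin n → ℕ
    t₁ a b = 𝟙 (least₂ a b) * h a b
    t₂ a b = 𝟙 (least₂ b a) * h a b
    L : ℕ
    L = ∑² t₁
    rotated : ∑² t₂ ≡ L
    rotated = trans (∑²-swap t₂) (∑²-cong (λ a b → cong (𝟙 (least₂ a b) *_) (h-sym b a)))
    pointwise : ∀ a b → t₁ a b + t₂ a b ≤ h a b
    pointwise a b = subst (_≤ h a b) (*-distribʳ-+ (h a b) (𝟙 (least₂ a b)) (𝟙 (least₂ b a)))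
      (≤1⇒*≤ (h a b) (𝟙-exclusive₂ _ _ (≺-asym a b)))

  least₃-∑³ : ∀ h → (∀ a b c → h a b c ≡ h b a c) → (∀ a b c → h a b c ≡ h a c b) →
              3 * ∑³ (λ a b c → 𝟙 (least₃ a b c) * h a b c) ≤ ∑³ h
  least₃-∑³ h h-sym₁₂ h-sym₂₃ = begin
      3 * L                                     ≡⟨ times3 L ⟩
      L + L + L                                 ≡⟨ cong₂ (λ x y → L + x + y) rotated₂ rotated₃ ⟨
      L + ∑³ t₂ + ∑³ t₃                         ≡⟨ cong (_+ ∑³ t₃) (∑³-distrib-+ t₁ t₂) ⟨
      ∑³ (λ a b c → t₁ a b c + t₂ a b c) + ∑³ t₃ ≡⟨ ∑³-distrib-+ (λ a b c → t₁ a b c + t₂ a b c) t₃ ⟨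
      ∑³ (λ a b c → t₁ a b c + t₂ a b c + t₃ a b c) ≤⟨ ∑³-mono-≤ pointwise ⟩
      ∑³ h                                      ∎
    where
    open ≤-Reasoning
    times3 : ∀ x → 3 * x ≡ x + x + x
    times3 = solve-∀
    t₁ t₂ t₃ : Fin n → Fin n → Fin n → ℕ
    t₁ a b c = 𝟙 (least₃ a b c) * h a b c
    t₂ a b c = 𝟙 (least₃ b a c) * h a b c
    t₃ a b c = 𝟙 (least₃ c a b) * h a b c
    L : ℕ
    L = ∑³ t₁
    rotated₂ : ∑³ t₂ ≡ L
    rotated₂ = trans (∑³-swap₁₂ t₂)
      (∑³-cong (λ a b c → cong (𝟙 (least₃ a b c) *_) (sym (h-sym₁₂ a b c))))
    rotated₃ : ∑³ t₃ ≡ L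
    rotated₃ = trans (trans (∑³-swap₂₃ t₃) (∑³-swap₁₂ (λ a b c → t₃ a c b)))
      (∑³-cong (λ a b c → cong (𝟙 (least₃ a b c) *_)
        (trans (h-sym₂₃ b c a) (h-sym₁₂ b a c))))
    pointwise : ∀ a b c → t₁ a b c + t₂ a b c + t₃ a b c ≤ h a b c
    pointwise a b c = subst (_≤ h a b c)
      (distrib₃ (𝟙 (least₃ a b c)) (𝟙 (least₃ b a c)) (𝟙 (least₃ c a b)) (h a b c))
      (≤1⇒*≤ (h a b c) (𝟙-exclusive₃ (least₃ a b c) (least₃ b a c) (least₃ c a b)
        (λ p → ∧-false₁ _ (≺-asym a b (∧-true₁ p)))
        (λ p → ∧-false₁ _ (≺-asym a c (∧-true₂ {a ≺ b} p)))
        (λ q → ∧-false₂ (c ≺ a) (≺-asym b c (∧-true₂ {b ≺ a} q)))))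
      where
      distrib₃ : ∀ x y z m → (x + y + z) * m ≡ x * m + y * m + z * m
      distrib₃ = solve-∀

  least₄-∑⁴ : ∀ h → (∀ a b c d → h a b c d ≡ h b a c d) → (∀ a b c d → h a b c d ≡ h a c b d) →
              (∀ a b c d → h a b c d ≡ h a b d c) →
              4 * ∑⁴ (λ a b c d → 𝟙 (least₄ a b c d) * h a b c d) ≤ ∑⁴ h
  least₄-∑⁴ h h-sym₁₂ h-sym₂₃ h-sym₃₄ = begin
      4 * L                                        ≡⟨ times4 L ⟩
      L + L + L + L                                ≡⟨ cong₂ (λ x y → L + x + y + L) rotated₂ rotated₃ ⟨
      L + ∑⁴ t₂ + ∑⁴ t₃ + L                        ≡⟨ cong (L + ∑⁴ t₂ + ∑⁴ t₃ +_) rotated₄ ⟨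
      L + ∑⁴ t₂ + ∑⁴ t₃ + ∑⁴ t₄                    ≡⟨ regroup ⟨
      ∑⁴ (λ a b c d → t₁ a b c d + t₂ a b c d + t₃ a b c d + t₄ a b c d) ≤⟨ ∑⁴-mono-≤ pointwise ⟩
      ∑⁴ h                                         ∎
    where
    open ≤-Reasoning
    times4 : ∀ x → 4 * x ≡ x + x + x + x
    times4 = solve-∀
    t₁ t₂ t₃ t₄ : Fin n → Fin n → Fin n → Fin n → ℕ
    t₁ a b c d = 𝟙 (least₄ a b c d) * h a b c d
    t₂ a b c d = 𝟙 (least₄ b a c d) * h a b c d
    t₃ a b c d = 𝟙 (least₄ c a b d) * h a b c d
    t₄ a b c d = 𝟙 (least₄ d a b c) * h a b c d
    L : ℕ
    L = ∑⁴ t₁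
    regroup : ∑⁴ (λ a b c d → t₁ a b c d + t₂ a b c d + t₃ a b c d + t₄ a b c d)
              ≡ L + ∑⁴ t₂ + ∑⁴ t₃ + ∑⁴ t₄
    regroup = trans (∑⁴-distrib-+ (λ a b c d → t₁ a b c d + t₂ a b c d + t₃ a b c d) t₄) (cong (_+ ∑⁴ t₄)
                (trans (∑⁴-distrib-+ (λ a b c d → t₁ a b c d + t₂ a b c d) t₃)
                       (cong (_+ ∑⁴ t₃) (∑⁴-distrib-+ t₁ t₂))))
    rotated₂ : ∑⁴ t₂ ≡ L
    rotated₂ = trans (∑⁴-swap₁₂ t₂)
      (∑⁴-cong (λ a b c d → cong (𝟙 (least₄ a b c d) *_) (sym (h-sym₁₂ a b c d))))
    rotated₃ : ∑⁴ t₃ ≡ L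
    rotated₃ = trans (trans (∑⁴-swap₂₃ t₃) (∑⁴-swap₁₂ (λ a b c d → t₃ a c b d)))
      (∑⁴-cong (λ a b c d → cong (𝟙 (least₄ a b c d) *_)
        (trans (h-sym₂₃ b c a d) (h-sym₁₂ b a c d))))
    rotated₄ : ∑⁴ t₄ ≡ L
    rotated₄ = trans (trans (∑⁴-swap₃₄ t₄)
                           (trans (∑⁴-swap₂₃ (λ a b c d → t₄ a b d c)) (∑⁴-swap₁₂ (λ a b c d → t₄ a c d b))))
      (∑⁴-cong (λ a b c d → cong (𝟙 (least₄ a b c d) *_)
        (trans (h-sym₃₄ b c d a) (trans (h-sym₂₃ b c a d) (h-sym₁₂ b a c d)))))
    pointwise : ∀ a b c d → t₁ a b c d + t₂ a b c d + t₃ a b c d + t₄ a b c d ≤ h a b c d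
    pointwise a b c d = subst (_≤ h a b c d)
      (distrib₄ (𝟙 (least₄ a b c d)) (𝟙 (least₄ b a c d)) (𝟙 (least₄ c a b d)) (𝟙 (least₄ d a b c)) (h a b c d))
      (≤1⇒*≤ (h a b c d) (𝟙-exclusive₄ (least₄ a b c d) (least₄ b a c d) (least₄ c a b d) (least₄ d a b c)
        (λ p → ∧-false₁ _ (≺-asym a b (∧-true₁ p)))
        (λ p → ∧-false₁ _ (≺-asym a c (∧-true₁ (∧-true₂ {a ≺ b} p))))
        (λ p → ∧-false₁ _ (≺-asym a d (∧-true₂ {a ≺ c} (∧-true₂ {a ≺ b} p))))
        (λ q → ∧-false₂ (c ≺ a) (∧-false₁ _ (≺-asym b c (∧-true₁ (∧-true₂ {b ≺ a} q)))))
        (λ q → ∧-false₂ (d ≺ a) (∧-false₁ _ (≺-asym b d (∧-true₂ {b ≺ c} (∧-true₂ {b ≺ a} q)))))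
        (λ r → ∧-false₂ (d ≺ a) (∧-false₂ (d ≺ b) (≺-asym c d (∧-true₂ {c ≺ b} (∧-true₂ {c ≺ a} r)))))))
      where
      distrib₄ : ∀ x y z w m → (x + y + z + w) * m ≡ x * m + y * m + z * m + w * m
      distrib₄ = solve-∀

  sorted₄⇒least : ∀ a b c d m → 𝟙 (sorted₄ a b c d) * m ≤
                  𝟙 (least₂ c d) * (𝟙 (least₃ b c d) * (𝟙 (least₄ a b c d) * m))
  sorted₄⇒least a b c d m with sorted₄ a b c d in abcd
  ... | false = z≤n
  ... | true = all-least (∧-true₁ abcd) (∧-true₁ (∧-true₂ {a ≺ b} abcd))
                         (∧-true₂ {b ≺ c} (∧-true₂ {a ≺ b} abcd))
    where
    all-least : a ≺ b ≡ true → b ≺ c ≡ true → c ≺ d ≡ true →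
                𝟙 true * m ≤ 𝟙 (least₂ c d) * (𝟙 (least₃ b c d) * (𝟙 (least₄ a b c d) * m))
    all-least a≺b b≺c c≺d rewrite a≺b | b≺c | c≺d | ≺-trans b c d b≺c c≺d
      | ≺-trans a b c a≺b b≺c | ≺-trans a c d (≺-trans a b c a≺b b≺c) c≺d
      = ≤-reflexive (units m)
      where
      units : ∀ m → 1 * m ≡ 1 * (1 * (1 * m))
      units = solve-∀

  -- 24 = 4 · 3 · 2: in a sorted quadruple a is the least entry, b the least of
  -- b, c, d, and c ≺ d.
  sorted₄-∑⁴ : ∀ g → (∀ a b c d → g a b c d ≡ g b a c d) → (∀ a b c d → g a b c d ≡ g a c b d) →
               (∀ a b c d → g a b c d ≡ g a b d c) →
               24 * ∑⁴ (λ a b c d → 𝟙 (sorted₄ a b c d) * g a b c d) ≤ ∑⁴ g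
  sorted₄-∑⁴ g g-sym₁₂ g-sym₂₃ g-sym₃₄ = begin
      24 * ∑⁴ (λ a b c d → 𝟙 (sorted₄ a b c d) * g a b c d)
        ≤⟨ *-monoʳ-≤ 24 (∑⁴-mono-≤ (λ a b c d → sorted₄⇒least a b c d (g a b c d))) ⟩
      24 * ∑⁴ r
        ≡⟨ pull-constants ⟩
      4 * (3 * ∑[ a < n ] ∑[ b < n ] (2 * ∑² (r a b)))
        ≤⟨ *-monoʳ-≤ 4 (*-monoʳ-≤ 3 (∑-mono-≤ λ a → ∑-mono-≤ λ b →
             least₂-∑² (m a b) (m-sym₃₄ a b))) ⟩
      4 * (3 * ∑[ a < n ] ∑³ (m a))
        ≡⟨ cong (4 *_) (*-distribˡ-sum 3 (λ a → ∑³ (m a))) ⟩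
      4 * ∑[ a < n ] (3 * ∑³ (m a))
        ≤⟨ *-monoʳ-≤ 4 (∑-mono-≤ λ a → least₃-∑³ (k a) (k-sym₂₃ a) (k-sym₃₄ a)) ⟩
      4 * ∑⁴ k
        ≤⟨ least₄-∑⁴ g g-sym₁₂ g-sym₂₃ g-sym₃₄ ⟩
      ∑⁴ g ∎
    where
    open ≤-Reasoning
    k m r : Fin n → Fin n → Fin n → Fin n → ℕ
    k a b c d = 𝟙 (least₄ a b c d) * g a b c d
    m a b c d = 𝟙 (least₃ b c d) * k a b c d
    r a b c d = 𝟙 (least₂ c d) * m a b c d
    k-sym₂₃ : ∀ a b c d → k a b c d ≡ k a c b d
    k-sym₂₃ a b c d = cong₂ (λ x y → 𝟙 x * y) (swap-first (a ≺ b) (a ≺ c) (a ≺ d)) (g-sym₂₃ a b c d)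
      where
      swap-first : ∀ x y z → (x ∧ y ∧ z) ≡ (y ∧ x ∧ z)
      swap-first x y z = trans (sym (∧-assoc x y z)) (trans (cong (_∧ z) (∧-comm x y)) (∧-assoc y x z))
    k-sym₃₄ : ∀ a b c d → k a b c d ≡ k a b d c
    k-sym₃₄ a b c d = cong₂ (λ x y → 𝟙 (a ≺ b ∧ x) * y) (∧-comm (a ≺ c) (a ≺ d)) (g-sym₃₄ a b c d)
    m-sym₃₄ : ∀ a b c d → m a b c d ≡ m a b d c
    m-sym₃₄ a b c d = cong₂ (λ x y → 𝟙 x * y) (∧-comm (b ≺ c) (b ≺ d)) (k-sym₃₄ a b c d)
    pull-constants : 24 * ∑⁴ r ≡ 4 * (3 * ∑[ a < n ] ∑[ b < n ] (2 * ∑² (r a b)))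
    pull-constants = trans (*-assoc 4 6 (∑⁴ r)) (cong (4 *_) (trans (*-assoc 3 2 (∑⁴ r)) (cong (3 *_)
      (trans (*-distribˡ-sum 2 (λ a → ∑³ (r a))) (sum-cong-≗ λ a → *-distribˡ-sum 2 (λ b → ∑² (r a b)))))))

∑ˡ : {A : Set} → List A → (A → ℕ) → ℕ
∑ˡ [] w = 0
∑ˡ (x ∷ xs) w = w x + ∑ˡ xs w

∑ˡ-++ : {A : Set} (xs ys : List A) (w : A → ℕ) → ∑ˡ (xs ++ ys) w ≡ ∑ˡ xs w + ∑ˡ ys w
∑ˡ-++ [] ys w = refl
∑ˡ-++ (x ∷ xs) ys w = trans (cong (w x +_) (∑ˡ-++ xs ys w)) (sym (+-assoc (w x) _ _))

∑ˡ-concatMap : {A B : Set} (f : A → List B) (xs : List A) (w : B → ℕ) →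
               ∑ˡ (concatMap f xs) w ≡ ∑ˡ xs (λ x → ∑ˡ (f x) w)
∑ˡ-concatMap f [] w = refl
∑ˡ-concatMap f (x ∷ xs) w = trans (∑ˡ-++ (f x) (concatMap f xs) w) (cong (∑ˡ (f x) w +_) (∑ˡ-concatMap f xs w))

∑ˡ-map : {A B : Set} (f : A → B) (xs : List A) (w : B → ℕ) → ∑ˡ (map f xs) w ≡ ∑ˡ xs (w ∘ f)
∑ˡ-map f [] w = refl
∑ˡ-map f (x ∷ xs) w = cong (w (f x) +_) (∑ˡ-map f xs w)

∑ˡ-filter : {A : Set} (p : A → Bool) (xs : List A) (w : A → ℕ) →
            ∑ˡ (filter (T? ∘ p) xs) w ≡ ∑ˡ xs (λ x → 𝟙 (p x) * w x)
∑ˡ-filter p [] w = refl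
∑ˡ-filter p (x ∷ xs) w with p x
... | true = cong₂ _+_ (sym (+-identityʳ (w x))) (∑ˡ-filter p xs w)
... | false = ∑ˡ-filter p xs w

length≡∑ˡ1 : {A : Set} (xs : List A) → length xs ≡ ∑ˡ xs (λ _ → 1)
length≡∑ˡ1 [] = refl
length≡∑ˡ1 (x ∷ xs) = cong suc (length≡∑ˡ1 xs)

∑ˡ-tabulate : ∀ {A : Set} {n} (f : Fin n → A) (w : A → ℕ) → ∑ˡ (tabulate f) w ≡ sum (w ∘ f)
∑ˡ-tabulate {n = zero} f w = refl
∑ˡ-tabulate {n = suc n} f w = cong (w (f zero) +_) (∑ˡ-tabulate (f ∘ suc) w)

∑ˡ-allFin : ∀ {n} (w : Fin n → ℕ) → ∑ˡ (allFin n) w ≡ sum w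
∑ˡ-allFin w = ∑ˡ-tabulate (λ i → i) w

module _ {n : ℕ} where

  above : Fin n → List (Fin n)
  above i = filter (λ j → T? (i ≺ j)) (allFin n)

  ∑ˡ-above : ∀ i (w : Fin n → ℕ) → ∑ˡ (above i) w ≡ ∑[ j < n ] (𝟙 (i ≺ j) * w j)
  ∑ˡ-above i w = trans (∑ˡ-filter (i ≺_) (allFin n) w) (∑ˡ-allFin (λ j → 𝟙 (i ≺ j) * w j))

  𝟙-*-∑ : ∀ x (y : Fin n → Bool) (f : Fin n → ℕ) →
          𝟙 x * ∑[ j < n ] (𝟙 (y j) * f j) ≡ ∑[ j < n ] (𝟙 (x ∧ y j) * f j)
  𝟙-*-∑ x y f = trans (*-distribˡ-sum (𝟙 x) (λ j → 𝟙 (y j) * f j)) (sum-cong-≗ λ j →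
    trans (sym (*-assoc (𝟙 x) (𝟙 (y j)) (f j))) (cong (_* f j) (sym (𝟙-∧ x (y j)))))

  ∑ˡ-quads : ∀ (w : Quad n → ℕ) →
             ∑ˡ (quads n) w ≡ ∑⁴ (λ a b c d → 𝟙 (sorted₄ a b c d) * w (quad a b c d))
  ∑ˡ-quads w = begin
    ∑ˡ (quads n) w
      ≡⟨ trans (∑ˡ-concatMap Fa (allFin n) w) (∑ˡ-allFin (λ a → ∑ˡ (Fa a) w)) ⟩
    ∑[ a < n ] ∑ˡ (Fa a) w
      ≡⟨ sum-cong-≗ (λ a → trans (∑ˡ-concatMap (Fb a) (above a) w) (∑ˡ-above a (λ b → ∑ˡ (Fb a b) w))) ⟩
    ∑[ a < n ] ∑[ b < n ] (𝟙 (a ≺ b) * ∑ˡ (Fb a b) w)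
      ≡⟨ sum-cong-≗ (λ a → sum-cong-≗ λ b → cong (𝟙 (a ≺ b) *_)
           (trans (∑ˡ-concatMap (Fc a b) (above b) w) (∑ˡ-above b (λ c → ∑ˡ (Fc a b c) w)))) ⟩
    ∑[ a < n ] ∑[ b < n ] (𝟙 (a ≺ b) * ∑[ c < n ] (𝟙 (b ≺ c) * ∑ˡ (Fc a b c) w))
      ≡⟨ sum-cong-≗ (λ a → sum-cong-≗ λ b → cong (𝟙 (a ≺ b) *_) (sum-cong-≗ λ c → cong (𝟙 (b ≺ c) *_)
           (trans (∑ˡ-map (quad a b c) (above c) w) (∑ˡ-above c (λ d → w (quad a b c d)))))) ⟩
    ∑[ a < n ] ∑[ b < n ] (𝟙 (a ≺ b) * ∑[ c < n ] (𝟙 (b ≺ c) * ∑[ d < n ] (𝟙 (c ≺ d) * w (quad a b c d))))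
      ≡⟨ sum-cong-≗ (λ a → sum-cong-≗ λ b → trans
           (cong (𝟙 (a ≺ b) *_) (sum-cong-≗ λ c → 𝟙-*-∑ (b ≺ c) (c ≺_) (λ d → w (quad a b c d))))
           (trans (*-distribˡ-sum (𝟙 (a ≺ b)) (λ c → ∑[ d < n ] (𝟙 (b ≺ c ∧ c ≺ d) * w (quad a b c d))))
                  (sum-cong-≗ λ c → 𝟙-*-∑ (a ≺ b) (λ d → b ≺ c ∧ c ≺ d) (λ d → w (quad a b c d))))) ⟩
    ∑⁴ (λ a b c d → 𝟙 (sorted₄ a b c d) * w (quad a b c d)) ∎
    where
    open ≡-Reasoning
    Fc : Fin n → Fin n → Fin n → List (Quad n)
    Fc a b c = map (quad a b c) (above c)
    Fb : Fin n → Fin n → List (Quad n)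
    Fb a b = concatMap (Fc a b) (above b)
    Fa : Fin n → List (Quad n)
    Fa a = concatMap (Fb a) (above a)

N≡∑⁴ : ∀ {n} (M : Matrix n) →
       N M ≡ ∑⁴ (λ a b c d → 𝟙 (sorted₄ a b c d) * 𝟙 (twoDisjointEdges M a b c d))
N≡∑⁴ {n} M = begin
  N M ≡⟨ length≡∑ˡ1 (filter (T? ∘ P) (quads n)) ⟩
  ∑ˡ (filter (T? ∘ P) (quads n)) (λ _ → 1) ≡⟨ ∑ˡ-filter P (quads n) (λ _ → 1) ⟩
  ∑ˡ (quads n) (λ q → 𝟙 (P q) * 1) ≡⟨ ∑ˡ-quads (λ q → 𝟙 (P q) * 1) ⟩
  ∑⁴ (λ a b c d → 𝟙 (sorted₄ a b c d) * (𝟙 (twoDisjointEdges M a b c d) * 1))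
      ≡⟨ ∑⁴-cong (λ a b c d → cong (𝟙 (sorted₄ a b c d) *_) (*-identityʳ (𝟙 (twoDisjointEdges M a b c d)))) ⟩
  ∑⁴ (λ a b c d → 𝟙 (sorted₄ a b c d) * 𝟙 (twoDisjointEdges M a b c d)) ∎
  where
  open ≡-Reasoning
  P : Quad n → Bool
  P q = twoDisjointEdges M (Quad.a q) (Quad.b q) (Quad.c q) (Quad.d q)

-- Pairs separated by two cuts

infix 8 _⁴

_⁴ : ℕ → ℕ
x ⁴ = (x * x) * (x * x)

am-gm : ∀ x y → 4 * (x * y) ≤ (x + y) * (x + y)
am-gm x y = [ ordered , (λ y≤x → subst₂ (λ u v → 4 * u ≤ v * v) (*-comm y x) (+-comm y x) (ordered y≤x)) ]′
              (≤-total x y)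
  where
  square-gap : ∀ x k → 4 * (x * (x + k)) + k * k ≡ (x + (x + k)) * (x + (x + k))
  square-gap = solve-∀
  ordered : ∀ {x y} → x ≤ y → 4 * (x * y) ≤ (x + y) * (x + y)
  ordered {x} {y} x≤y = subst (λ y → 4 * (x * y) ≤ (x + y) * (x + y)) (m+[n∸m]≡n x≤y)
    (subst (4 * (x * (x + (y ∸ x))) ≤_) (square-gap x (y ∸ x)) (m≤m+n _ _))

≢⇒==not : ∀ x y → 𝟙 (not (x == y)) ≡ 𝟙 (y == not x)
≢⇒==not true true = refl
≢⇒==not true false = refl
≢⇒==not false true = refl
≢⇒==not false false = refl

bool-split : ∀ (G : Bool → ℕ) x → G x ≡ 𝟙 (x == true) * G true + 𝟙 (x == false) * G false
bool-split G true = sym (trans (cong (_+ 0) (+-identityʳ (G true))) (+-identityʳ (G true)))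
bool-split G false = sym (+-identityʳ (G false))

module _ {n : ℕ} (h : Fin n → ℕ) (β δ : Fin n → Bool) where

  weight : Bool → Bool → ℕ
  weight u v = ∑[ c < n ] (h c * (𝟙 (β c == u) * 𝟙 (δ c == v)))

  ∑-by-classes : ∀ (F : Bool → Bool → ℕ) → ∑[ a < n ] (h a * F (β a) (δ a)) ≡
    weight true true * F true true + weight true false * F true false +
    weight false true * F false true + weight false false * F false false
  ∑-by-classes F = begin
    ∑[ a < n ] (h a * F (β a) (δ a))
      ≡⟨ sum-cong-≗ (λ a → split (h a) (β a) (δ a)) ⟩
    ∑[ a < n ] (t true true a + t true false a + t false true a + t false false a)
      ≡⟨ trans (∑-distrib-+ (λ a → t true true a + t true false a + t false true a) (t false false))
           (cong (_+ sum (t false false)) (trans (∑-distrib-+ (λ a → t true true a + t true false a) (t false true))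
             (cong (_+ sum (t false true)) (∑-distrib-+ (t true true) (t true false))))) ⟩
    sum (t true true) + sum (t true false) + sum (t false true) + sum (t false false)
      ≡⟨ cong₂ _+_ (cong₂ _+_ (cong₂ _+_ (pull true true) (pull true false)) (pull false true)) (pull false false) ⟩
    weight true true * F true true + weight true false * F true false +
    weight false true * F false true + weight false false * F false false ∎
    where
    open ≡-Reasoning
    t : Bool → Bool → Fin n → ℕ
    t u v a = h a * (𝟙 (β a == u) * 𝟙 (δ a == v)) * F u v
    pull : ∀ u v → sum (t u v) ≡ weight u v * F u v
    pull u v = sym (*-distribʳ-sum (F u v) (λ a → h a * (𝟙 (β a == u) * 𝟙 (δ a == v))))
    split : ∀ m x y → m * F x y ≡
            m * (𝟙 (x == true) * 𝟙 (y == true)) * F true true + m * (𝟙 (x == true) * 𝟙 (y == false)) * F true false +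
            m * (𝟙 (x == false) * 𝟙 (y == true)) * F false true + m * (𝟙 (x == false) * 𝟙 (y == false)) * F false false
    split m x y = trans (cong (m *_) (trans (bool-split (λ u → F u y) x)
                    (cong₂ (λ p q → 𝟙 (x == true) * p + 𝟙 (x == false) * q)
                           (bool-split (F true) y) (bool-split (F false) y))))
                  (expand m (𝟙 (x == true)) (𝟙 (x == false)) (𝟙 (y == true)) (𝟙 (y == false))
                    (F true true) (F true false) (F false true) (F false false))
      where
      expand : ∀ m x₁ x₀ y₁ y₀ a b c d →
               m * (x₁ * (y₁ * a + y₀ * b) + x₀ * (y₁ * c + y₀ * d)) ≡
               m * (x₁ * y₁) * a + m * (x₁ * y₀) * b + m * (x₀ * y₁) * c + m * (x₀ * y₀) * d
      expand = solve-∀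

  -- Pairs separated by both β and δ lie in opposite classes, so their weight is
  -- 2 (P S + Q R) ≤ (P + Q + R + S)² / 2 by AM-GM.
  separated-pairs-≤ : 2 * ∑² (λ a c → (h a * h c) * (𝟙 (not (β a == β c)) * 𝟙 (not (δ a == δ c))))
                      ≤ sum h * sum h
  separated-pairs-≤ = begin
    2 * ∑² (λ a c → (h a * h c) * (𝟙 (not (β a == β c)) * 𝟙 (not (δ a == δ c))))
      ≡⟨ cong (2 *_) (sum-cong-≗ opposite-class) ⟩
    2 * ∑[ a < n ] (h a * weight (not (β a)) (not (δ a)))
      ≡⟨ cong (2 *_) (∑-by-classes (λ u v → weight (not u) (not v))) ⟩
    2 * (P * S + Q * R + R * Q + S * P)
      ≤⟨ pairing-≤ ⟩
    (P + Q + R + S) * (P + Q + R + S)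
      ≡⟨ cong (λ x → x * x) total ⟨
    sum h * sum h ∎
    where
    open ≤-Reasoning
    P Q R S : ℕ
    P = weight true true
    Q = weight true false
    R = weight false true
    S = weight false false
    opposite-class : ∀ a → ∑[ c < n ] ((h a * h c) * (𝟙 (not (β a == β c)) * 𝟙 (not (δ a == δ c))))
                           ≡ h a * weight (not (β a)) (not (δ a))
    opposite-class a = trans (sum-cong-≗ λ c → trans (*-assoc (h a) (h c) _)
        (cong (λ z → h a * (h c * z)) (cong₂ _*_ (≢⇒==not (β a) (β c)) (≢⇒==not (δ a) (δ c)))))
      (sym (*-distribˡ-sum (h a) (λ c → h c * (𝟙 (β c == not (β a)) * 𝟙 (δ c == not (δ a))))))
    total : sum h ≡ P + Q + R + S
    total = trans (sum-cong-≗ λ a → sym (*-identityʳ (h a)))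
      (trans (∑-by-classes (λ _ _ → 1)) (drop-ones P Q R S))
      where
      drop-ones : ∀ P Q R S → P * 1 + Q * 1 + R * 1 + S * 1 ≡ P + Q + R + S
      drop-ones = solve-∀
    pairing-≤ : 2 * (P * S + Q * R + R * Q + S * P) ≤ (P + Q + R + S) * (P + Q + R + S)
    pairing-≤ = begin
      2 * (P * S + Q * R + R * Q + S * P)    ≡⟨ regroup P Q R S ⟩
      4 * (P * S) + 4 * (Q * R)              ≤⟨ +-mono-≤ (am-gm P S) (am-gm Q R) ⟩
      (P + S) * (P + S) + (Q + R) * (Q + R)  ≤⟨ m≤m+n _ (2 * ((P + S) * (Q + R))) ⟩
      (P + S) * (P + S) + (Q + R) * (Q + R) + 2 * ((P + S) * (Q + R)) ≡⟨ square P Q R S ⟩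
      (P + Q + R + S) * (P + Q + R + S)      ∎
      where
      regroup : ∀ P Q R S → 2 * (P * S + Q * R + R * Q + S * P) ≡ 4 * (P * S) + 4 * (Q * R)
      regroup = solve-∀
      square : ∀ P Q R S → (P + S) * (P + S) + (Q + R) * (Q + R) + 2 * ((P + S) * (Q + R))
                           ≡ (P + Q + R + S) * (P + Q + R + S)
      square = solve-∀

-- The upper bound for properly 2-coloured graphs

twoEdgePattern : Bool → Bool → Bool → Bool → Bool → Bool → Bool
twoEdgePattern ab ac ad bc bd cd =
    (ab ∧ cd ∧ not ac ∧ not ad ∧ not bc ∧ not bd)
  ∨ (ac ∧ bd ∧ not ab ∧ not ad ∧ not bc ∧ not cd)
  ∨ (ad ∧ bc ∧ not ab ∧ not ac ∧ not bd ∧ not cd)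

twoEdgePattern-swap₁₂ : ∀ ab ac ad bc bd cd → twoEdgePattern ab bc bd ac ad cd ≡ twoEdgePattern ab ac ad bc bd cd
twoEdgePattern-swap₁₂ ab ac ad bc bd cd = ==⇒≡ (tautology-sound 6 (λ ab ac ad bc bd cd →
  twoEdgePattern ab bc bd ac ad cd == twoEdgePattern ab ac ad bc bd cd) refl ab ac ad bc bd cd)

twoEdgePattern-swap₂₃ : ∀ ab ac ad bc bd cd → twoEdgePattern ac ab ad bc cd bd ≡ twoEdgePattern ab ac ad bc bd cd
twoEdgePattern-swap₂₃ ab ac ad bc bd cd = ==⇒≡ (tautology-sound 6 (λ ab ac ad bc bd cd →
  twoEdgePattern ac ab ad bc cd bd == twoEdgePattern ab ac ad bc bd cd) refl ab ac ad bc bd cd)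

twoEdgePattern-swap₃₄ : ∀ ab ac ad bc bd cd → twoEdgePattern ab ad ac bd bc cd ≡ twoEdgePattern ab ac ad bc bd cd
twoEdgePattern-swap₃₄ ab ac ad bc bd cd = ==⇒≡ (tautology-sound 6 (λ ab ac ad bc bd cd →
  twoEdgePattern ab ad ac bd bc cd == twoEdgePattern ab ac ad bc bd cd) refl ab ac ad bc bd cd)

matching-facts : ∀ ab cd ac ad bc bd → (ab ∧ cd ∧ not ac ∧ not ad ∧ not bc ∧ not bd) ≡ true →
                 ab ≡ true × cd ≡ true × ac ≡ false × ad ≡ false × bc ≡ false × bd ≡ false
matching-facts true true false false false false refl = refl , refl , refl , refl , refl , refl
matching-facts false _ _ _ _ _ ()
matching-facts true false _ _ _ _ ()
matching-facts true true true _ _ _ ()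
matching-facts true true false true _ _ ()
matching-facts true true false false true _ ()
matching-facts true true false false false true ()

𝟙-∨₃-≤ : ∀ x y z → 𝟙 (x ∨ y ∨ z) ≤ 𝟙 x + 𝟙 y + 𝟙 z
𝟙-∨₃-≤ true y z = s≤s z≤n
𝟙-∨₃-≤ false true z = s≤s z≤n
𝟙-∨₃-≤ false false true = s≤s z≤n
𝟙-∨₃-≤ false false false = z≤n

1≤𝟙[x==¬y]+𝟙[x==y] : ∀ x y → 1 ≤ 𝟙 (x == not y) * 1 + 𝟙 (x == y) * 1
1≤𝟙[x==¬y]+𝟙[x==y] true true = s≤s z≤n
1≤𝟙[x==¬y]+𝟙[x==y] true false = s≤s z≤n
1≤𝟙[x==¬y]+𝟙[x==y] false true = s≤s z≤n
1≤𝟙[x==¬y]+𝟙[x==y] false false = s≤s z≤n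

module UpperBound {n : ℕ} (e : Fin n → Fin n → Bool) (col : Fin n → Bool)
                  (e-sym : ∀ i j → e i j ≡ e j i)
                  (e-proper : ∀ i j → e i j ≡ true → col i ≡ not (col j)) where

  induced : Fin n → Fin n → Fin n → Fin n → ℕ
  induced a b c d = 𝟙 (twoEdgePattern (e a b) (e a c) (e a d) (e b c) (e b d) (e c d))

  induced-sym₁₂ : ∀ a b c d → induced a b c d ≡ induced b a c d
  induced-sym₁₂ a b c d = cong 𝟙 (trans (sym (twoEdgePattern-swap₁₂ (e a b) (e a c) (e a d) (e b c) (e b d) (e c d)))
    (cong (λ ba → twoEdgePattern ba (e b c) (e b d) (e a c) (e a d) (e c d)) (e-sym a b)))

  induced-sym₂₃ : ∀ a b c d → induced a b c d ≡ induced a c b d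
  induced-sym₂₃ a b c d = cong 𝟙 (trans (sym (twoEdgePattern-swap₂₃ (e a b) (e a c) (e a d) (e b c) (e b d) (e c d)))
    (cong (λ cb → twoEdgePattern (e a c) (e a b) (e a d) cb (e c d) (e b d)) (e-sym b c)))

  induced-sym₃₄ : ∀ a b c d → induced a b c d ≡ induced a b d c
  induced-sym₃₄ a b c d = cong 𝟙 (trans (sym (twoEdgePattern-swap₃₄ (e a b) (e a c) (e a d) (e b c) (e b d) (e c d)))
    (cong (λ dc → twoEdgePattern (e a b) (e a d) (e a c) (e b d) (e b c) dc) (e-sym c d)))

  matching : Fin n → Fin n → Fin n → Fin n → ℕ
  matching a b c d = 𝟙 (e a b ∧ e c d ∧ not (e a c) ∧ not (e a d) ∧ not (e b c) ∧ not (e b d))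

  induced≤matchings : ∀ a b c d → induced a b c d ≤ matching a b c d + matching a c b d + matching a d b c
  induced≤matchings a b c d =
    subst₂ (λ x y → induced a b c d ≤ matching a b c d + 𝟙 x + 𝟙 y) acbd adbc
      (𝟙-∨₃-≤ (e a b ∧ e c d ∧ not (e a c) ∧ not (e a d) ∧ not (e b c) ∧ not (e b d))
               (e a c ∧ e b d ∧ not (e a b) ∧ not (e a d) ∧ not (e b c) ∧ not (e c d))
               (e a d ∧ e b c ∧ not (e a b) ∧ not (e a c) ∧ not (e b d) ∧ not (e c d)))
    where
    acbd : (e a c ∧ e b d ∧ not (e a b) ∧ not (e a d) ∧ not (e b c) ∧ not (e c d))
           ≡ (e a c ∧ e b d ∧ not (e a b) ∧ not (e a d) ∧ not (e c b) ∧ not (e c d))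
    acbd = cong (λ z → e a c ∧ e b d ∧ not (e a b) ∧ not (e a d) ∧ not z ∧ not (e c d)) (e-sym b c)
    adbc : (e a d ∧ e b c ∧ not (e a b) ∧ not (e a c) ∧ not (e b d) ∧ not (e c d))
           ≡ (e a d ∧ e b c ∧ not (e a b) ∧ not (e a c) ∧ not (e d b) ∧ not (e d c))
    adbc = cong₂ (λ z w → e a d ∧ e b c ∧ not (e a b) ∧ not (e a c) ∧ not z ∧ not w) (e-sym b d) (e-sym c d)

  ∑induced≤3∑matching : ∑⁴ induced ≤ 3 * ∑⁴ matching
  ∑induced≤3∑matching = begin
    ∑⁴ induced
      ≤⟨ ∑⁴-mono-≤ induced≤matchings ⟩
    ∑⁴ (λ a b c d → matching a b c d + matching a c b d + matching a d b c)
      ≡⟨ trans (∑⁴-distrib-+ (λ a b c d → matching a b c d + matching a c b d) (λ a b c d → matching a d b c))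
           (cong (_+ ∑⁴ (λ a b c d → matching a d b c)) (∑⁴-distrib-+ matching (λ a b c d → matching a c b d))) ⟩
    ∑⁴ matching + ∑⁴ (λ a b c d → matching a c b d) + ∑⁴ (λ a b c d → matching a d b c)
      ≡⟨ cong₂ (λ x y → ∑⁴ matching + x + y) (∑⁴-swap₂₃ matching)
           (trans (∑⁴-swap₂₃ matching) (∑⁴-swap₃₄ (λ a b c d → matching a c b d))) ⟨
    ∑⁴ matching + ∑⁴ matching + ∑⁴ matching
      ≡⟨ thrice (∑⁴ matching) ⟩
    3 * ∑⁴ matching ∎
    where
    open ≤-Reasoning
    thrice : ∀ x → x + x + x ≡ 3 * x
    thrice = solve-∀

  crossing : Fin n → Fin n → Fin n → Fin n → ℕ
  crossing a b c d = 𝟙 (col a == col c) * (𝟙 (e a b ∧ not (e c b)) * 𝟙 (e c d ∧ not (e a d)))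

  -- The edge cd joins the two sides, so a is on the side of exactly one of c, d.
  matching≤crossings : ∀ a b c d → matching a b c d ≤ crossing a b c d + crossing a b d c
  matching≤crossings a b c d
    with e a b ∧ e c d ∧ not (e a c) ∧ not (e a d) ∧ not (e b c) ∧ not (e b d) in m
  ... | false = z≤n
  ... | true with matching-facts (e a b) (e c d) (e a c) (e a d) (e b c) (e b d) m
  ...   | ab , cd , ac , ad , bc , bd
    rewrite e-sym c b | e-sym d b | e-sym d c | ab | cd | ac | ad | bc | bd | e-proper c d cd
    = 1≤𝟙[x==¬y]+𝟙[x==y] (col a) (col d)

  ∑matching≤2∑crossing : ∑⁴ matching ≤ 2 * ∑⁴ crossing
  ∑matching≤2∑crossing = begin
    ∑⁴ matching                                           ≤⟨ ∑⁴-mono-≤ matching≤crossings ⟩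
    ∑⁴ (λ a b c d → crossing a b c d + crossing a b d c)   ≡⟨ ∑⁴-distrib-+ crossing (λ a b c d → crossing a b d c) ⟩
    ∑⁴ crossing + ∑⁴ (λ a b c d → crossing a b d c)        ≡⟨ cong (∑⁴ crossing +_) (∑⁴-swap₃₄ crossing) ⟨
    ∑⁴ crossing + ∑⁴ crossing                              ≡⟨ cong (∑⁴ crossing +_) (+-identityʳ (∑⁴ crossing)) ⟨
    2 * ∑⁴ crossing                                        ∎
    where open ≤-Reasoning

  privateNbrs : Fin n → Fin n → ℕ
  privateNbrs a c = ∑[ b < n ] 𝟙 (e a b ∧ not (e c b))

  ∑crossing≡ : ∑⁴ crossing ≡ ∑² (λ a c → 𝟙 (col a == col c) * (privateNbrs a c * privateNbrs c a))
  ∑crossing≡ = trans (∑⁴-swap₂₃ crossing) (sum-cong-≗ λ a → sum-cong-≗ λ c → begin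
    ∑[ b < n ] ∑[ d < n ] (s a c * (u a c b * u c a d))   ≡⟨ sum-cong-≗ (λ b → *-distribˡ-sum (s a c) (λ d → u a c b * u c a d)) ⟨
    ∑[ b < n ] (s a c * ∑[ d < n ] (u a c b * u c a d))   ≡⟨ *-distribˡ-sum (s a c) (λ b → ∑[ d < n ] (u a c b * u c a d)) ⟨
    s a c * ∑² (λ b d → u a c b * u c a d)                ≡⟨ cong (s a c *_) (∑-*-∑ (u a c) (u c a)) ⟨
    s a c * (privateNbrs a c * privateNbrs c a)           ∎)
    where
    open ≡-Reasoning
    s : Fin n → Fin n → ℕ
    s a c = 𝟙 (col a == col c)
    u : Fin n → Fin n → Fin n → ℕ
    u a c b = 𝟙 (e a b ∧ not (e c b))

  symDiff : Fin n → Fin n → ℕ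
  symDiff a c = ∑[ b < n ] 𝟙 (not (col a == col b) ∧ not (e a b == e c b))

  privateNbrs+≤symDiff : ∀ a c → col a ≡ col c → privateNbrs a c + privateNbrs c a ≤ symDiff a c
  privateNbrs+≤symDiff a c same = begin
    privateNbrs a c + privateNbrs c a
      ≡⟨ ∑-distrib-+ (λ b → 𝟙 (e a b ∧ not (e c b))) (λ b → 𝟙 (e c b ∧ not (e a b))) ⟨
    ∑[ b < n ] (𝟙 (e a b ∧ not (e c b)) + 𝟙 (e c b ∧ not (e a b)))
      ≤⟨ ∑-mono-≤ (λ b → pointwise (e a b) (e c b) (col b) (e-proper a b) (e-proper c b)) ⟩
    symDiff a c ∎
    where
    open ≤-Reasoning
    pointwise : ∀ x y cb → (x ≡ true → col a ≡ not cb) → (y ≡ true → col c ≡ not cb) →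
                𝟙 (x ∧ not y) + 𝟙 (y ∧ not x) ≤ 𝟙 (not (col a == cb) ∧ not (x == y))
    pointwise true true cb _ _ = z≤n
    pointwise false false cb _ _ = z≤n
    pointwise true false true x⇒ _ rewrite x⇒ refl = ≤-refl
    pointwise true false false x⇒ _ rewrite x⇒ refl = ≤-refl
    pointwise false true true _ y⇒ rewrite same | y⇒ refl = ≤-refl
    pointwise false true false _ y⇒ rewrite same | y⇒ refl = ≤-refl

  4∑crossing≤∑symDiff² : 4 * ∑⁴ crossing ≤ ∑² (λ a c → 𝟙 (col a == col c) * (symDiff a c * symDiff a c))
  4∑crossing≤∑symDiff² = begin
    4 * ∑⁴ crossing
      ≡⟨ cong (4 *_) ∑crossing≡ ⟩
    4 * ∑² (λ a c → 𝟙 (col a == col c) * (privateNbrs a c * privateNbrs c a))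
      ≡⟨ ∑²-*ˡ 4 (λ a c → 𝟙 (col a == col c) * (privateNbrs a c * privateNbrs c a)) ⟩
    ∑² (λ a c → 4 * (𝟙 (col a == col c) * (privateNbrs a c * privateNbrs c a)))
      ≤⟨ ∑²-mono-≤ pointwise ⟩
    ∑² (λ a c → 𝟙 (col a == col c) * (symDiff a c * symDiff a c)) ∎
    where
    open ≤-Reasoning
    pointwise : ∀ a c → 4 * (𝟙 (col a == col c) * (privateNbrs a c * privateNbrs c a))
                        ≤ 𝟙 (col a == col c) * (symDiff a c * symDiff a c)
    pointwise a c with col a == col c in same
    ... | false = z≤n
    ... | true = subst₂ _≤_ (cong (4 *_) (sym (*-identityˡ (privateNbrs a c * privateNbrs c a))))
                   (sym (*-identityˡ (symDiff a c * symDiff a c)))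
                   (≤-trans (am-gm (privateNbrs a c) (privateNbrs c a)) (*-mono-≤ bound bound))
      where
      bound : privateNbrs a c + privateNbrs c a ≤ symDiff a c
      bound = privateNbrs+≤symDiff a c (==⇒≡ same)

  oppositeToBoth : Fin n → Fin n → Fin n → ℕ
  oppositeToBoth b d a = 𝟙 (not (col a == col b) ∧ not (col a == col d))

  ∑symDiff²≤ : ∑² (λ a c → 𝟙 (col a == col c) * (symDiff a c * symDiff a c)) ≤
               ∑² (λ b d → ∑² (λ a c → (oppositeToBoth b d a * oppositeToBoth b d c) *
                                        (𝟙 (not (e a b == e c b)) * 𝟙 (not (e a d == e c d)))))
  ∑symDiff²≤ = begin
    ∑² (λ a c → 𝟙 (col a == col c) * (symDiff a c * symDiff a c))
      ≡⟨ sum-cong-≗ (λ a → sum-cong-≗ λ c → trans (cong (𝟙 (col a == col c) *_) (∑-*-∑ (w a c) (w a c)))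
           (∑²-*ˡ (𝟙 (col a == col c)) (λ b d → w a c b * w a c d))) ⟩
    ∑² (λ a c → ∑² (λ b d → 𝟙 (col a == col c) * (w a c b * w a c d)))
      ≤⟨ ∑²-mono-≤ (λ a c → ∑²-mono-≤ λ b d → pointwise (col a) (col c) (col b) (col d)
                               (not (e a b == e c b)) (not (e a d == e c d))) ⟩
    ∑² (λ a c → ∑² (λ b d → V a c b d))
      ≡⟨ ∑²-∑²-comm V ⟩
    ∑² (λ b d → ∑² (λ a c → V a c b d)) ∎
    where
    open ≤-Reasoning
    w : Fin n → Fin n → Fin n → ℕ
    w a c b = 𝟙 (not (col a == col b) ∧ not (e a b == e c b))
    V : Fin n → Fin n → Fin n → Fin n → ℕ
    V a c b d = (oppositeToBoth b d a * oppositeToBoth b d c) * (𝟙 (not (e a b == e c b)) * 𝟙 (not (e a d == e c d)))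
    pointwise : ∀ ca cc cb cd y₁ y₂ →
      𝟙 (ca == cc) * (𝟙 (not (ca == cb) ∧ y₁) * 𝟙 (not (ca == cd) ∧ y₂)) ≤
      (𝟙 (not (ca == cb) ∧ not (ca == cd)) * 𝟙 (not (cc == cb) ∧ not (cc == cd))) * (𝟙 y₁ * 𝟙 y₂)
    pointwise ca cc cb cd y₁ y₂ = ≤ᵇ⇒≤ _ _ (Equivalence.from T-≡ (tautology-sound 6 (λ ca cc cb cd y₁ y₂ →
      𝟙 (ca == cc) * (𝟙 (not (ca == cb) ∧ y₁) * 𝟙 (not (ca == cd) ∧ y₂)) ≤ᵇ
      (𝟙 (not (ca == cb) ∧ not (ca == cd)) * 𝟙 (not (cc == cb) ∧ not (cc == cd))) * (𝟙 y₁ * 𝟙 y₂)) refl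
      ca cc cb cd y₁ y₂))

  side : Bool → ℕ
  side v = ∑[ a < n ] 𝟙 (col a == v)

  ∑oppositeToBoth≡ : ∀ b d → sum (oppositeToBoth b d) ≡ 𝟙 (col b == col d) * side (not (col b))
  ∑oppositeToBoth≡ b d = trans (sum-cong-≗ λ a → opposite (col a) (col b) (col d))
                                (sym (*-distribˡ-sum (𝟙 (col b == col d)) (λ a → 𝟙 (col a == not (col b)))))
    where
    opposite : ∀ ca cb cd → 𝟙 (not (ca == cb) ∧ not (ca == cd)) ≡ 𝟙 (cb == cd) * 𝟙 (ca == not cb)
    opposite ca cb cd = trans (cong 𝟙 (==⇒≡ (tautology-sound 3 (λ ca cb cd →
      (not (ca == cb) ∧ not (ca == cd)) == ((cb == cd) ∧ (ca == not cb))) refl ca cb cd)))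
      (𝟙-∧ (cb == cd) (ca == not cb))

  sides : side true + side false ≡ n
  sides = trans (sym (∑-distrib-+ (λ a → 𝟙 (col a == true)) (λ a → 𝟙 (col a == false))))
                (trans (sum-cong-≗ λ a → one (col a)) (∑1≡n n))
    where
    one : ∀ v → 𝟙 (v == true) + 𝟙 (v == false) ≡ 1
    one true = refl
    one false = refl

  ∑∑opposite²≡ : ∑² (λ b d → sum (oppositeToBoth b d) * sum (oppositeToBoth b d)) ≡
                 side true * (side true * (side false * side false)) +
                 side false * (side false * (side true * side true))
  ∑∑opposite²≡ = begin
    ∑² (λ b d → sum (oppositeToBoth b d) * sum (oppositeToBoth b d))
      ≡⟨ ∑²-cong (λ b d → trans (cong (λ x → x * x) (∑oppositeToBoth≡ b d))
                                  (square (col b == col d) (side (not (col b))))) ⟩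
    ∑² (λ b d → 𝟙 (col b == col d) * otherSide² b)
      ≡⟨ sum-cong-≗ (λ b → trans (sym (*-distribʳ-sum (otherSide² b) (λ d → 𝟙 (col b == col d))))
           (cong (_* otherSide² b) (sum-cong-≗ λ d → cong 𝟙 (==-comm (col b) (col d))))) ⟩
    ∑[ b < n ] sideTerm (col b)
      ≡⟨ sum-cong-≗ (λ b → bool-split sideTerm (col b)) ⟩
    ∑[ b < n ] (𝟙 (col b == true) * sideTerm true + 𝟙 (col b == false) * sideTerm false)
      ≡⟨ ∑-distrib-+ (λ b → 𝟙 (col b == true) * sideTerm true) (λ b → 𝟙 (col b == false) * sideTerm false) ⟩
    ∑[ b < n ] (𝟙 (col b == true) * sideTerm true) + ∑[ b < n ] (𝟙 (col b == false) * sideTerm false)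
      ≡⟨ cong₂ _+_ (*-distribʳ-sum (sideTerm true) (λ b → 𝟙 (col b == true)))
                   (*-distribʳ-sum (sideTerm false) (λ b → 𝟙 (col b == false))) ⟨
    side true * sideTerm true + side false * sideTerm false ∎
    where
    open ≡-Reasoning
    otherSide² : Fin n → ℕ
    otherSide² b = side (not (col b)) * side (not (col b))
    sideTerm : Bool → ℕ
    sideTerm v = side v * (side (not v) * side (not v))
    square : ∀ x k → (𝟙 x * k) * (𝟙 x * k) ≡ 𝟙 x * (k * k)
    square true = solve-∀
    square false k = refl

  8∑∑opposite²≤n⁴ : 8 * ∑² (λ b d → sum (oppositeToBoth b d) * sum (oppositeToBoth b d)) ≤ n ⁴
  8∑∑opposite²≤n⁴ = begin
    8 * ∑² (λ b d → sum (oppositeToBoth b d) * sum (oppositeToBoth b d))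
      ≡⟨ cong (8 *_) ∑∑opposite²≡ ⟩
    8 * (p * (p * (q * q)) + q * (q * (p * p)))
      ≡⟨ regroup p q ⟩
    (4 * (p * q)) * (4 * (p * q))
      ≤⟨ *-mono-≤ (am-gm p q) (am-gm p q) ⟩
    ((p + q) * (p + q)) * ((p + q) * (p + q))
      ≡⟨ cong (λ m → (m * m) * (m * m)) sides ⟩
    n ⁴ ∎
    where
    open ≤-Reasoning
    p q : ℕ
    p = side true
    q = side false
    regroup : ∀ p q → 8 * (p * (p * (q * q)) + q * (q * (p * p))) ≡ (4 * (p * q)) * (4 * (p * q))
    regroup = solve-∀

  16∑symDiff²≤n⁴ : 16 * ∑² (λ a c → 𝟙 (col a == col c) * (symDiff a c * symDiff a c)) ≤ n ⁴
  16∑symDiff²≤n⁴ = begin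
    16 * ∑² (λ a c → 𝟙 (col a == col c) * (symDiff a c * symDiff a c))
      ≤⟨ *-monoʳ-≤ 16 ∑symDiff²≤ ⟩
    16 * W
      ≡⟨ *-assoc 8 2 W ⟩
    8 * (2 * W)
      ≡⟨ cong (8 *_) (∑²-*ˡ 2 (λ b d → ∑² (V b d))) ⟩
    8 * ∑² (λ b d → 2 * ∑² (V b d))
      ≤⟨ *-monoʳ-≤ 8 (∑²-mono-≤ λ b d → separated-pairs-≤ (oppositeToBoth b d) (λ a → e a b) (λ a → e a d)) ⟩
    8 * ∑² (λ b d → sum (oppositeToBoth b d) * sum (oppositeToBoth b d))
      ≤⟨ 8∑∑opposite²≤n⁴ ⟩
    n ⁴ ∎
    where
    open ≤-Reasoning
    V : Fin n → Fin n → Fin n → Fin n → ℕ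
    V b d a c = (oppositeToBoth b d a * oppositeToBoth b d c) * (𝟙 (not (e a b == e c b)) * 𝟙 (not (e a d == e c d)))
    W : ℕ
    W = ∑² (λ b d → ∑² (V b d))

  256∑sorted-induced≤n⁴ : 256 * ∑⁴ (λ a b c d → 𝟙 (sorted₄ a b c d) * induced a b c d) ≤ n ⁴
  256∑sorted-induced≤n⁴ = *-cancelˡ-≤ 24 (begin
    24 * (256 * S)                 ≡⟨ reorder₁ S ⟩
    256 * (24 * S)                 ≤⟨ *-monoʳ-≤ 256 (sorted₄-∑⁴ induced induced-sym₁₂ induced-sym₂₃ induced-sym₃₄) ⟩
    256 * ∑⁴ induced               ≤⟨ *-monoʳ-≤ 256 ∑induced≤3∑matching ⟩
    256 * (3 * ∑⁴ matching)        ≤⟨ *-monoʳ-≤ 256 (*-monoʳ-≤ 3 ∑matching≤2∑crossing) ⟩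
    256 * (3 * (2 * ∑⁴ crossing))  ≡⟨ reorder₂ (∑⁴ crossing) ⟩
    24 * (16 * (4 * ∑⁴ crossing))  ≤⟨ *-monoʳ-≤ 24 (*-monoʳ-≤ 16 4∑crossing≤∑symDiff²) ⟩
    24 * (16 * ∑² (λ a c → 𝟙 (col a == col c) * (symDiff a c * symDiff a c)))
                                   ≤⟨ *-monoʳ-≤ 24 16∑symDiff²≤n⁴ ⟩
    24 * n ⁴                       ∎)
    where
    open ≤-Reasoning
    S : ℕ
    S = ∑⁴ (λ a b c d → 𝟙 (sorted₄ a b c d) * induced a b c d)
    reorder₁ : ∀ x → 24 * (256 * x) ≡ 256 * (24 * x)
    reorder₁ = solve-∀
    reorder₂ : ∀ x → 256 * (3 * (2 * x)) ≡ 24 * (16 * (4 * x))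
    reorder₂ = solve-∀

Good : ∀ {n} → Matrix n → Set
Good M = T (isSimple M ∧ isBipartite M)

T-all : ∀ {A : Set} (p : A → Bool) {xs x} → T (all p xs) → x ∈ xs → T (p x)
T-all p {xs} holds = All.lookup (all⁺ p xs holds)

T-all-intro : ∀ {A : Set} (p : A → Bool) xs → (∀ x → T (p x)) → T (all p xs)
T-all-intro p xs holds = all⁻ p {xs} (All.tabulate λ {x} _ → holds x)

T-any-intro : ∀ {A : Set} (p : A → Bool) {xs x} → x ∈ xs → T (p x) → T (any p xs)
T-any-intro p x∈xs px = any⁺ p (Any.map (λ { refl → px }) x∈xs)

*-foldr-⊔-≤ : ∀ k X (xs : List ℕ) → All (λ x → k * x ≤ X) xs → k * foldr _⊔_ 0 xs ≤ X
*-foldr-⊔-≤ k X [] [] = subst (_≤ X) (sym (*-zeroʳ k)) z≤n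
*-foldr-⊔-≤ k X (x ∷ xs) (kx≤X ∷ kxs≤X) =
  subst (_≤ X) (sym (*-distribˡ-⊔ k x _)) (⊔-lub kx≤X (*-foldr-⊔-≤ k X xs kxs≤X))

∈⇒≤foldr-⊔ : ∀ {x} (xs : List ℕ) → x ∈ xs → x ≤ foldr _⊔_ 0 xs
∈⇒≤foldr-⊔ (x ∷ xs) (here refl) = m≤m⊔n x _
∈⇒≤foldr-⊔ (y ∷ xs) (there x∈xs) = ≤-trans (∈⇒≤foldr-⊔ xs x∈xs) (m≤n⊔m y _)

bools-complete : ∀ b → b ∈ bools
bools-complete true = here refl
bools-complete false = there (here refl)

allVecs-complete : ∀ {A : Set} (xs : List A) → (∀ x → x ∈ xs) → ∀ {n} (v : Vec A n) → v ∈ allVecs xs n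
allVecs-complete xs complete []ᵥ = here refl
allVecs-complete xs complete {suc n} (x ∷ᵥ v) =
  ∈-concat⁺′ (∈-map⁺ (x ∷ᵥ_) (allVecs-complete xs complete v))
             (∈-map⁺ (λ x → map (x ∷ᵥ_) (allVecs xs n)) (complete x))

maxN-lub : ∀ {n} k X → (∀ (M : Matrix n) → Good M → k * N M ≤ X) → k * maxN n ≤ X
maxN-lub {n} k X bound = *-foldr-⊔-≤ k X _
  (map⁺ (All.map (λ {M} → bound M) (all-filter (λ M → T? (isSimple M ∧ isBipartite M)) (allVecs (allVecs bools n) n))))

N≤maxN : ∀ {n} (M : Matrix n) → Good M → N M ≤ maxN n
N≤maxN {n} M good = ∈⇒≤foldr-⊔ _ (∈-map⁺ N (∈-filter⁺ (λ M → T? (isSimple M ∧ isBipartite M))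
  (allVecs-complete (allVecs bools n) (allVecs-complete bools bools-complete) M) good))

not==⇒≡not : ∀ x y → T (not (x == y)) → x ≡ not y
not==⇒≡not true false _ = refl
not==⇒≡not false true _ = refl

module GoodMatrix {n : ℕ} (M : Matrix n) (good : Good M) where

  simple : T (isSimple M)
  simple = proj₁ (Equivalence.to (T-∧ {isSimple M} {isBipartite M}) good)

  bipartite : T (isBipartite M)
  bipartite = proj₂ (Equivalence.to (T-∧ {isSimple M} {isBipartite M}) good)

  adj-sym : ∀ i j → adj M i j ≡ adj M j i
  adj-sym i j = ==⇒≡ (Equivalence.to T-≡ (T-all _ row-sym (∈-allFin j)))
    where
    row-sym : T (all (λ j → adj M i j == adj M j i) (allFin n))
    row-sym = proj₂ (Equivalence.to (T-∧ {not (adj M i i)}) (T-all _ simple (∈-allFin i)))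

  isProperColouring : Vec Bool n → Bool
  isProperColouring c = all (λ i → all (λ j → not (adj M i j) ∨ not (lookup c i == lookup c j)) (allFin n)) (allFin n)

  colouring : ∃[ c ] T (isProperColouring c)
  colouring = satisfied (any⁻ isProperColouring (allVecs bools n) bipartite)

  colour : Fin n → Bool
  colour = lookup (proj₁ colouring)

  adj-proper : ∀ i j → adj M i j ≡ true → colour i ≡ not (colour j)
  adj-proper i j i~j with Equivalence.to (T-∨ {not (adj M i j)})
                            (T-all _ (T-all _ (proj₂ colouring) (∈-allFin i)) (∈-allFin j))
  ... | inj₁ i≁j = ⊥-elim (subst (T ∘ not) i~j i≁j)
  ... | inj₂ different = not==⇒≡not (colour i) (colour j) different

  256*N≤n⁴ : 256 * N M ≤ n ⁴
  256*N≤n⁴ = subst (λ z → 256 * z ≤ n ⁴) (sym (N≡∑⁴ M))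
    (UpperBound.256∑sorted-induced≤n⁴ (adj M) colour adj-sym adj-proper)

256*maxN≤n⁴ : ∀ n → 256 * maxN n ≤ n ⁴
256*maxN≤n⁴ n = maxN-lub {n} 256 (n ⁴) GoodMatrix.256*N≤n⁴

-- The lower bound

-- The extremal graph is two disjoint copies of K_{m,m}: blocks 0, 1, 2, 3 are
-- labelled by their binary digits (copy, side); later blocks are isolated.
label : ℕ → Maybe (Bool × Bool)
label 0 = just (false , false)
label 1 = just (false , true)
label 2 = just (true , false)
label 3 = just (true , true)
label _ = nothing

joined : Maybe (Bool × Bool) → Maybe (Bool × Bool) → Bool
joined (just (copy , side)) (just (copy′ , side′)) = (copy == copy′) ∧ not (side == side′)
joined _ _ = false

sideOf : Maybe (Bool × Bool) → Bool
sideOf (just (_ , side)) = side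
sideOf nothing = false

joined-irrefl : ∀ x → joined x x ≡ false
joined-irrefl (just (copy , side)) rewrite ==-refl side = ∧-false₂ (copy == copy) refl
joined-irrefl nothing = refl

joined-sym : ∀ x y → joined x y ≡ joined y x
joined-sym (just (c , s)) (just (c′ , s′)) = cong₂ (λ p q → p ∧ not q) (==-comm c c′) (==-comm s s′)
joined-sym (just _) nothing = refl
joined-sym nothing (just _) = refl
joined-sym nothing nothing = refl

joined-proper : ∀ x y → T (not (joined x y) ∨ not (sideOf x == sideOf y))
joined-proper (just (c , s)) (just (c′ , s′)) = Equivalence.from T-≡ (tautology-sound 4 (λ c s c′ s′ →
  not ((c == c′) ∧ not (s == s′)) ∨ not (s == s′)) refl c s c′ s′)
joined-proper (just _) nothing = _
joined-proper nothing _ = _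

m≤∑-window : ∀ {n} s m (f : ℕ → ℕ) → s + m ≤ n → (∀ r → r < m → f (s + r) ≡ 1) → m ≤ ∑[ i < n ] f (toℕ i)
m≤∑-window zero zero f _ _ = z≤n
m≤∑-window {suc n} zero (suc m) f (s≤s m≤n) ones rewrite ones 0 z<s =
  s≤s (m≤∑-window zero m (f ∘ suc) m≤n (λ r r<m → ones (suc r) (s<s r<m)))
m≤∑-window {suc n} (suc s) m f (s≤s s+m≤n) ones =
  ≤-trans (m≤∑-window s m (f ∘ suc) s+m≤n ones) (m≤n+m _ (f 0))

module Construction (n m : ℕ) .{{_ : NonZero m}} (4m≤n : 4 * m ≤ n) where

  block : Fin n → ℕ
  block i = toℕ i / m

  edge : Fin n → Fin n → Bool
  edge i j = joined (label (block i)) (label (block j))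

  colour : Fin n → Bool
  colour i = sideOf (label (block i))

  M : Matrix n
  M = Vec.tabulate (λ i → Vec.tabulate (edge i))

  adj-M : ∀ i j → adj M i j ≡ edge i j
  adj-M i j rewrite lookup∘tabulate (λ i → Vec.tabulate (edge i)) i = lookup∘tabulate (edge i) j

  simple : T (isSimple M)
  simple = T-all-intro _ (allFin n) λ i →
    Equivalence.from T-∧ (loopless i , T-all-intro _ (allFin n) (symmetric i))
    where
    loopless : ∀ i → T (not (adj M i i))
    loopless i rewrite adj-M i i | joined-irrefl (label (block i)) = _
    symmetric : ∀ i j → T (adj M i j == adj M j i)
    symmetric i j rewrite adj-M i j | adj-M j i | joined-sym (label (block i)) (label (block j)) =
      Equivalence.from T-≡ (==-refl (edge j i))

  bipartite : T (isBipartite M)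
  bipartite = T-any-intro _ (allVecs-complete bools bools-complete (Vec.tabulate colour))
    (T-all-intro _ (allFin n) λ i → T-all-intro _ (allFin n) λ j → proper i j)
    where
    proper : ∀ i j → T (not (adj M i j) ∨ not (lookup (Vec.tabulate colour) i == lookup (Vec.tabulate colour) j))
    proper i j rewrite adj-M i j | lookup∘tabulate colour i | lookup∘tabulate colour j =
      joined-proper (label (block i)) (label (block j))

  good : Good M
  good = Equivalence.from T-∧ (simple , bipartite)

  inBlock : ℕ → Fin n → ℕ
  inBlock k i = 𝟙 (block i ≡ᵇ k)

  m≤|block| : ∀ k → suc k * m ≤ n → m ≤ sum (inBlock k)
  m≤|block| k fits = m≤∑-window (k * m) m (λ x → 𝟙 (x / m ≡ᵇ k)) (subst (_≤ n) (+-comm m (k * m)) fits) inside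
    where
    inside : ∀ r → r < m → 𝟙 ((k * m + r) / m ≡ᵇ k) ≡ 1
    inside r r<m = trans (cong (λ x → 𝟙 (x ≡ᵇ k)) quotient) (cong 𝟙 (Equivalence.to T-≡ (≡⇒≡ᵇ k k refl)))
      where
      quotient : (k * m + r) / m ≡ k
      quotient = trans (+-distrib-/-∣ˡ {k * m} r {m} (divides-refl k))
                   (trans (cong₂ _+_ (m*n/n≡m k m) (m<n⇒m/n≡0 r<m)) (+-identityʳ k))

  edge-between : ∀ i j {k l} → block i ≡ k → block j ≡ l → adj M i j ≡ joined (label k) (label l)
  edge-between i j refl refl = adj-M i j

  ≺-by-block : ∀ i j → block i < block j → i ≺ j ≡ true
  ≺-by-block i j i<j = <⇒≺ {i = i} {j} (≰⇒> λ j≤i → <⇒≱ i<j (/-monoˡ-≤ m j≤i))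

  one-per-block : ∀ a b c d → inBlock 0 a * (inBlock 1 b * (inBlock 2 c * inBlock 3 d)) ≤
                              𝟙 (sorted₄ a b c d) * 𝟙 (twoDisjointEdges M a b c d)
  one-per-block a b c d with block a ≡ᵇ 0 in a₀ | block b ≡ᵇ 1 in b₁ | block c ≡ᵇ 2 in c₂ | block d ≡ᵇ 3 in d₃
  ... | false | _ | _ | _ = z≤n
  ... | true | false | _ | _ = z≤n
  ... | true | true | false | _ = z≤n
  ... | true | true | true | false = z≤n
  ... | true | true | true | true = ≤-reflexive (sym (cong₂ (λ x y → 𝟙 x * 𝟙 y) sorted two-edges))
    where
    in-block : ∀ i k → (block i ≡ᵇ k) ≡ true → block i ≡ k
    in-block i k eq = ≡ᵇ⇒≡ (block i) k (Equivalence.from T-≡ eq)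
    ba : block a ≡ 0
    ba = in-block a 0 a₀
    bb : block b ≡ 1
    bb = in-block b 1 b₁
    bc : block c ≡ 2
    bc = in-block c 2 c₂
    bd : block d ≡ 3
    bd = in-block d 3 d₃
    sorted : (a ≺ b ∧ b ≺ c ∧ c ≺ d) ≡ true
    sorted rewrite ≺-by-block a b (subst₂ _<_ (sym ba) (sym bb) (s≤s z≤n))
                 | ≺-by-block b c (subst₂ _<_ (sym bb) (sym bc) (s≤s (s≤s z≤n)))
                 | ≺-by-block c d (subst₂ _<_ (sym bc) (sym bd) (s≤s (s≤s (s≤s z≤n)))) = refl
    two-edges : twoEdgePattern (adj M a b) (adj M a c) (adj M a d) (adj M b c) (adj M b d) (adj M c d) ≡ true
    two-edges rewrite edge-between a b ba bb | edge-between a c ba bc | edge-between a d ba bd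
                  | edge-between b c bb bc | edge-between b d bb bd | edge-between c d bc bd = refl

  m⁴≤N : m * (m * (m * m)) ≤ N M
  m⁴≤N = begin
    m * (m * (m * m))
      ≤⟨ *-mono-≤ (m≤|block| 0 (fits 0 (s≤s z≤n))) (*-mono-≤ (m≤|block| 1 (fits 1 (s≤s (s≤s z≤n))))
           (*-mono-≤ (m≤|block| 2 (fits 2 (s≤s (s≤s (s≤s z≤n))))) (m≤|block| 3 4m≤n))) ⟩
    sum (inBlock 0) * (sum (inBlock 1) * (sum (inBlock 2) * sum (inBlock 3)))
      ≡⟨ ∑⁴-product (inBlock 0) (inBlock 1) (inBlock 2) (inBlock 3) ⟩
    ∑⁴ (λ a b c d → inBlock 0 a * (inBlock 1 b * (inBlock 2 c * inBlock 3 d)))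
      ≤⟨ ∑⁴-mono-≤ one-per-block ⟩
    ∑⁴ (λ a b c d → 𝟙 (sorted₄ a b c d) * 𝟙 (twoDisjointEdges M a b c d))
      ≡⟨ N≡∑⁴ M ⟨
    N M ∎
    where
    open ≤-Reasoning
    fits : ∀ k → suc k ≤ 4 → suc k * m ≤ n
    fits k k<4 = ≤-trans (*-monoˡ-≤ m k<4) 4m≤n

[n∸3]⁴≤256*maxN : ∀ n → (n ∸ 3) ⁴ ≤ 256 * maxN n
[n∸3]⁴≤256*maxN n with n / 4 in quarter
... | zero = subst (λ x → x ⁴ ≤ 256 * maxN n) (sym (n∸3≡0)) z≤n
  where
  n∸3≡0 : n ∸ 3 ≡ 0
  n∸3≡0 = m≤n⇒m∸n≡0 (s≤s⁻¹ (m/n≡0⇒m<n {n} {4} quarter))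
... | suc q = begin
    (n ∸ 3) ⁴                     ≤⟨ *-mono-≤ (*-mono-≤ n∸3≤4m n∸3≤4m) (*-mono-≤ n∸3≤4m n∸3≤4m) ⟩
    (4 * m) ⁴                     ≡⟨ expand m ⟩
    256 * (m * (m * (m * m)))     ≤⟨ *-monoʳ-≤ 256 (≤-trans (Construction.m⁴≤N n m 4m≤n)
                                    (N≤maxN (Construction.M n m 4m≤n) (Construction.good n m 4m≤n))) ⟩
    256 * maxN n                  ∎
  where
  open ≤-Reasoning
  m : ℕ
  m = suc q
  expand : ∀ m → ((4 * m) * (4 * m)) * ((4 * m) * (4 * m)) ≡ 256 * (m * (m * (m * m)))
  expand = solve-∀
  4m≤n : 4 * m ≤ n
  4m≤n = subst (_≤ n) (trans (cong (_* 4) quarter) (*-comm m 4)) (m/n*n≤m n 4)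
  n∸3≤4m : n ∸ 3 ≤ 4 * m
  n∸3≤4m = m≤n+o⇒m∸n≤o n 3 (begin
    n                    ≡⟨ m≡m%n+[m/n]*n n 4 ⟩
    n % 4 + n / 4 * 4    ≤⟨ +-mono-≤ (s≤s⁻¹ (m%n<n n 4)) (≤-reflexive (trans (cong (_* 4) quarter) (*-comm m 4))) ⟩
    3 + 4 * m            ∎)

-- The limit

2*C₂ : ∀ n → 2 * (suc n C 2) ≡ suc n * n
2*C₂ zero = refl
2*C₂ (suc n) = begin
  2 * ((2 + n) C 2)                  ≡⟨ cong (2 *_) (nCk+nC[k+1]≡[n+1]C[k+1] (suc n) 1) ⟨
  2 * (suc n C 1 + suc n C 2)        ≡⟨ *-distribˡ-+ 2 (suc n C 1) (suc n C 2) ⟩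
  2 * (suc n C 1) + 2 * (suc n C 2)  ≡⟨ cong₂ (λ x y → 2 * x + y) (nC1≡n (suc n)) (2*C₂ n) ⟩
  2 * suc n + suc n * n              ≡⟨ step n ⟩
  (2 + n) * suc n                    ∎
  where
  open ≡-Reasoning
  step : ∀ n → 2 * suc n + suc n * n ≡ (2 + n) * suc n
  step = solve-∀

6*C₃ : ∀ n → 6 * ((2 + n) C 3) ≡ (2 + n) * (suc n * n)
6*C₃ zero = refl
6*C₃ (suc n) = begin
  6 * ((3 + n) C 3)                              ≡⟨ cong (6 *_) (nCk+nC[k+1]≡[n+1]C[k+1] (2 + n) 2) ⟨
  6 * ((2 + n) C 2 + (2 + n) C 3)                ≡⟨ split ((2 + n) C 2) ((2 + n) C 3) ⟩
  3 * (2 * ((2 + n) C 2)) + 6 * ((2 + n) C 3)    ≡⟨ cong₂ (λ x y → 3 * x + y) (2*C₂ (suc n)) (6*C₃ n) ⟩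
  3 * ((2 + n) * suc n) + (2 + n) * (suc n * n)  ≡⟨ step n ⟩
  (3 + n) * ((2 + n) * suc n)                    ∎
  where
  open ≡-Reasoning
  split : ∀ x y → 6 * (x + y) ≡ 3 * (2 * x) + 6 * y
  split = solve-∀
  step : ∀ n → 3 * ((2 + n) * suc n) + (2 + n) * (suc n * n) ≡ (3 + n) * ((2 + n) * suc n)
  step = solve-∀

24*C₄ : ∀ n → 24 * ((3 + n) C 4) ≡ (3 + n) * ((2 + n) * (suc n * n))
24*C₄ zero = refl
24*C₄ (suc n) = begin
  24 * ((4 + n) C 4)
    ≡⟨ cong (24 *_) (nCk+nC[k+1]≡[n+1]C[k+1] (3 + n) 3) ⟨
  24 * ((3 + n) C 3 + (3 + n) C 4)
    ≡⟨ split ((3 + n) C 3) ((3 + n) C 4) ⟩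
  4 * (6 * ((3 + n) C 3)) + 24 * ((3 + n) C 4)
    ≡⟨ cong₂ (λ x y → 4 * x + y) (6*C₃ (suc n)) (24*C₄ n) ⟩
  4 * ((3 + n) * ((2 + n) * suc n)) + (3 + n) * ((2 + n) * (suc n * n))
    ≡⟨ step n ⟩
  (4 + n) * ((3 + n) * ((2 + n) * suc n))
    ∎
  where
  open ≡-Reasoning
  split : ∀ x y → 24 * (x + y) ≡ 4 * (6 * x) + 24 * y
  split = solve-∀
  step : ∀ n → 4 * ((3 + n) * ((2 + n) * suc n)) + (3 + n) * ((2 + n) * (suc n * n))
               ≡ (4 + n) * ((3 + n) * ((2 + n) * suc n))
  step = solve-∀

+/-<-+/+ε : ∀ a b c d k e .(cop : Coprime (suc k) (suc e)) →
            a * (suc d * suc e) < (c * suc e + suc k * suc d) * suc b →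
            (ℤ.+ a) ℚ./ suc b ℚ.< (ℤ.+ c) ℚ./ suc d ℚ.+ mkℚ +[1+ k ] e cop
+/-<-+/+ε a b c d k e cop cross = ℚ.toℚᵘ-cancel-<
  (ℚᵘ.<-respʳ-≃ (ℚᵘ.≃-sym (ℚᵘ.≃-trans (ℚ.toℚᵘ-homo-+ ((ℤ.+ c) ℚ./ suc d) (mkℚ +[1+ k ] e cop))
                                         (ℚᵘ.+-congˡ (ℚᵘ.mkℚᵘ +[1+ k ] e) (ℚ.toℚᵘ-fromℚᵘ (ℚᵘ.mkℚᵘ (ℤ.+ c) d)))))
  (ℚᵘ.<-respˡ-≃ (ℚᵘ.≃-sym (ℚ.toℚᵘ-fromℚᵘ (ℚᵘ.mkℚᵘ (ℤ.+ a) b)))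
  (ℚᵘ.*<* (subst₂ ℤ._<_ (ℤ.pos-* a (suc d * suc e))
    (trans (ℤ.pos-* (c * suc e + suc k * suc d) (suc b))
      (cong (ℤ._* ℤ.+ suc b) (trans (ℤ.pos-+ (c * suc e) (suc k * suc d))
        (cong₂ ℤ._+_ (ℤ.pos-* c (suc e)) (ℤ.pos-* (suc k) (suc d))))))
    (+<+ cross)))))

∣p-q∣<r : ∀ {p q r} → p ℚ.< q ℚ.+ r → q ℚ.< p ℚ.+ r → ℚ.∣ p ℚ.- q ∣ ℚ.< r
∣p-q∣<r {p} {q} {r} p<q+r q<p+r with ℚ.∣p∣≡p∨∣p∣≡-p (p ℚ.- q)
... | inj₁ ∣p-q∣≡p-q rewrite ∣p-q∣≡p-q = subst (p ℚ.- q ℚ.<_) (xyx⁻¹≈y q r) (ℚ.+-monoˡ-< (ℚ.- q) p<q+r)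
... | inj₂ ∣p-q∣≡q-p rewrite ∣p-q∣≡q-p =
  subst₂ ℚ._<_ (sym (⁻¹-anti-homo‿- p q)) (xyx⁻¹≈y p r) (ℚ.+-monoˡ-< (ℚ.- p) q<p+r)

[3+j]⁴≤j⁴+255j³ : ∀ j → 1 ≤ j → (3 + j) ⁴ ≤ j ⁴ + 255 * (j * (j * j))
[3+j]⁴≤j⁴+255j³ (suc i) _ =
  subst ((3 + suc i) ⁴ ≤_) (expansion i) (m≤m+n ((3 + suc i) ⁴) (243 * (i * (i * i)) + 675 * (i * i) + 513 * i))
  where
  expansion : ∀ i → ((4 + i) * (4 + i)) * ((4 + i) * (4 + i)) + (243 * (i * (i * i)) + 675 * (i * i) + 513 * i)
                    ≡ ((1 + i) * (1 + i)) * ((1 + i) * (1 + i)) + 255 * ((1 + i) * ((1 + i) * (1 + i)))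
  expansion = solve-∀

-- (3 + j)⁴ - j⁴ ≤ 255 j³ and 3 · 255 < 32 · 24; this is why N₀ = 24 D + 3 suffices.
3[3+j]⁴D<3j⁴D+32j⁴ : ∀ j D → 24 * D ≤ j → 1 ≤ D → 3 * (3 + j) ⁴ * D < 3 * j ⁴ * D + 32 * j ⁴
3[3+j]⁴D<3j⁴D+32j⁴ (suc i) (suc d) 24D≤j _ = begin-strict
  3 * (3 + j) ⁴ * D                          ≤⟨ *-monoˡ-≤ D (*-monoʳ-≤ 3 ([3+j]⁴≤j⁴+255j³ j (s≤s z≤n))) ⟩
  3 * (j ⁴ + 255 * j³) * D                   ≡⟨ spread (j ⁴) j³ D ⟩
  3 * j ⁴ * D + 765 * (j³ * D)               <⟨ +-monoʳ-< (3 * j ⁴ * D) (*-monoˡ-< (j³ * D) (≤ᵇ⇒≤ 766 768 _)) ⟩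
  3 * j ⁴ * D + 768 * (j³ * D)               ≡⟨ cong (λ x → 3 * j ⁴ * D + x) (regroup j³ D) ⟩
  3 * j ⁴ * D + 32 * (j³ * (24 * D))         ≤⟨ +-monoʳ-≤ (3 * j ⁴ * D) (*-monoʳ-≤ 32 (*-monoʳ-≤ j³ 24D≤j)) ⟩
  3 * j ⁴ * D + 32 * (j³ * j)                ≡⟨ cong (λ x → 3 * j ⁴ * D + 32 * x) (j³*j≡j⁴ j) ⟩
  3 * j ⁴ * D + 32 * j ⁴                     ∎
  where
  open ≤-Reasoning
  j D j³ : ℕ
  j = suc i
  D = suc d
  j³ = j * (j * j)
  spread : ∀ x y D → 3 * (x + 255 * y) * D ≡ 3 * x * D + 765 * (y * D)
  spread = solve-∀
  regroup : ∀ y D → 768 * (y * D) ≡ 32 * (y * (24 * D))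
  regroup = solve-∀
  j³*j≡j⁴ : ∀ j → j * (j * j) * j ≡ (j * j) * (j * j)
  j³*j≡j⁴ = solve-∀

sandwich : ∀ j D {x y z} → 24 * D ≤ j → 1 ≤ D → j ⁴ ≤ x → y ≤ (3 + j) ⁴ → j ⁴ ≤ z →
           3 * y * D < 3 * x * D + 32 * z
sandwich j D {x} {y} {z} 24D≤j 1≤D j⁴≤x y≤[3+j]⁴ j⁴≤z = begin-strict
  3 * y * D                ≤⟨ *-monoˡ-≤ D (*-monoʳ-≤ 3 y≤[3+j]⁴) ⟩
  3 * (3 + j) ⁴ * D        <⟨ 3[3+j]⁴D<3j⁴D+32j⁴ j D 24D≤j 1≤D ⟩
  3 * j ⁴ * D + 32 * j ⁴   ≤⟨ +-mono-≤ (*-monoˡ-≤ D (*-monoʳ-≤ 3 j⁴≤x)) (*-monoʳ-≤ 32 j⁴≤z) ⟩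
  3 * x * D + 32 * z       ∎
  where open ≤-Reasoning

-- Cross-multiplied forms of A / B < 3 / 32 + K / D and 3 / 32 < A / B + K / D,
-- derived from estimates for 256 A and 24 B.
cross₁ : ∀ A B D K → 1 ≤ K → 3 * (256 * A) * D < 3 * (24 * B) * D + 32 * (24 * B) →
         A * (32 * D) < (3 * D + K * 32) * B
cross₁ A B D K 1≤K estimate = *-cancelˡ-< 24 _ _ (begin-strict
  24 * (A * (32 * D))                          ≡⟨ lhs A D ⟩
  3 * (256 * A) * D                            <⟨ estimate ⟩
  3 * (24 * B) * D + 32 * (24 * B)             ≡⟨ rhs B D ⟩
  24 * ((3 * D + 1 * 32) * B)                  ≤⟨ *-monoʳ-≤ 24 (*-monoˡ-≤ B (+-monoʳ-≤ (3 * D) (*-monoˡ-≤ 32 1≤K))) ⟩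
  24 * ((3 * D + K * 32) * B)                  ∎)
  where
  open ≤-Reasoning
  lhs : ∀ A D → 24 * (A * (32 * D)) ≡ 3 * (256 * A) * D
  lhs = solve-∀
  rhs : ∀ B D → 3 * (24 * B) * D + 32 * (24 * B) ≡ 24 * ((3 * D + 1 * 32) * B)
  rhs = solve-∀

cross₂ : ∀ A B D K → 1 ≤ K → 3 * (24 * B) * D < 3 * (256 * A) * D + 32 * (24 * B) →
         3 * (B * D) < (A * D + K * B) * 32
cross₂ A B D K 1≤K estimate = *-cancelˡ-< 24 _ _ (begin-strict
  24 * (3 * (B * D))                           ≡⟨ lhs B D ⟩
  3 * (24 * B) * D                             <⟨ estimate ⟩
  3 * (256 * A) * D + 32 * (24 * B)            ≡⟨ rhs A B D ⟩
  24 * ((A * D + 1 * B) * 32)                  ≤⟨ *-monoʳ-≤ 24 (*-monoˡ-≤ 32 (+-monoʳ-≤ (A * D) (*-monoˡ-≤ B 1≤K))) ⟩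
  24 * ((A * D + K * B) * 32)                  ∎)
  where
  open ≤-Reasoning
  lhs : ∀ B D → 24 * (3 * (B * D)) ≡ 3 * (24 * B) * D
  lhs = solve-∀
  rhs : ∀ A B D → 3 * (256 * A) * D + 32 * (24 * B) ≡ 24 * ((A * D + 1 * B) * 32)
  rhs = solve-∀

j⁴≤24C : ∀ j → j ⁴ ≤ 24 * ((3 + j) C 4)
j⁴≤24C j = subst (j ⁴ ≤_) (sym (24*C₄ j))
  (subst (_≤ (3 + j) * ((2 + j) * (suc j * j))) (reassoc j)
    (*-mono-≤ (m≤n+m j 3) (*-mono-≤ (m≤n+m j 2) (*-mono-≤ (m≤n+m j 1) (≤-refl {j})))))
  where
  reassoc : ∀ j → j * (j * (j * j)) ≡ (j * j) * (j * j)
  reassoc = solve-∀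

24C≤[3+j]⁴ : ∀ j → 24 * ((3 + j) C 4) ≤ (3 + j) ⁴
24C≤[3+j]⁴ j = subst (_≤ (3 + j) ⁴) (sym (24*C₄ j))
  (subst ((3 + j) * ((2 + j) * (suc j * j)) ≤_) (reassoc (3 + j))
    (*-mono-≤ (≤-refl {3 + j}) (*-mono-≤ (m≤n+m (2 + j) 1) (*-mono-≤ (m≤n+m (1 + j) 2) (m≤n+m j 3)))))
  where
  reassoc : ∀ n → n * (n * (n * n)) ≡ (n * n) * (n * n)
  reassoc = solve-∀

frac-close : ∀ k d .(cop : Coprime (suc k) (suc d)) j A B → 24 * suc d ≤ j →
             j ⁴ ≤ 256 * A → 256 * A ≤ (3 + j) ⁴ → j ⁴ ≤ 24 * B → 24 * B ≤ (3 + j) ⁴ →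
             ℚ.∣ frac A B ℚ.- (ℤ.+ 3) ℚ./ 32 ∣ ℚ.< mkℚ +[1+ k ] d cop
frac-close k d cop zero _ _ () _ _ _ _
frac-close k d cop (suc i) A zero _ _ _ () _
frac-close k d cop j A (suc b) 24D≤j X-low X-high Y-low Y-high = ∣p-q∣<r
  (+/-<-+/+ε A b 3 31 k d cop (cross₁ A (suc b) (suc d) (suc k) (s≤s z≤n)
    (sandwich j (suc d) 24D≤j (s≤s z≤n) Y-low X-high Y-low)))
  (+/-<-+/+ε 3 31 A b k d cop (cross₂ A (suc b) (suc d) (suc k) (s≤s z≤n)
    (sandwich j (suc d) 24D≤j (s≤s z≤n) X-low Y-high Y-low)))

theorem9 : (ε : ℚ) → 0ℚ ℚ.< ε → ∃[ N₀ ] ((n : ℕ) → n ≥ N₀ → ℚ.∣ density n ℚ.- (ℤ.+ 3) ℚ./ 32 ∣ ℚ.< ε)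
theorem9 (mkℚ (ℤ.+ 0) _ _) 0<ε = ⊥-elim (ℤ.+≮0 (ℚ.drop-*<* 0<ε))
theorem9 (mkℚ -[1+ _ ] _ _) 0<ε = ⊥-elim (ℤ.+≮- (ℚ.drop-*<* 0<ε))
theorem9 (mkℚ +[1+ k ] d cop) _ = 24 * suc d + 3 , close
  where
  close : ∀ n → n ≥ 24 * suc d + 3 → ℚ.∣ density n ℚ.- (ℤ.+ 3) ℚ./ 32 ∣ ℚ.< mkℚ +[1+ k ] d cop
  close n n≥N₀ rewrite sym (m+[n∸m]≡n (≤-trans (m≤n+m 3 (24 * suc d)) n≥N₀)) =
    frac-close k d cop j (maxN (3 + j)) ((3 + j) C 4) 24D≤j
      ([n∸3]⁴≤256*maxN (3 + j)) (256*maxN≤n⁴ (3 + j)) (j⁴≤24C j) (24C≤[3+j]⁴ j)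
    where
    j : ℕ
    j = n ∸ 3
    24D≤j : 24 * suc d ≤ j
    24D≤j = subst (_≤ j) (m+n∸n≡m (24 * suc d) 3) (∸-monoˡ-≤ 3 n≥N₀)
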